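{- Let $T_\nu(n)$ be as defined in the context and let $\nu(q)=\sum_{n\ge0}(-q)^n(q;q^2)_n$. Then, as formal power series (equivalently for $|q|<1$), $$\sum_{n\ge1}T_\nu(n)q^n=q\,\nu(-q).$$
   Context: $(a;q)_n=\prod_{j=0}^{n-1}(1-aq^j)$, $(a;q)_\infty=\prod_{j\ge0}(1-aq^j)$. A two-color partition is a partition whose parts are each colored blue or green (the same integer may occur in both colors). $T_\nu(n)$ is the signed count of two-color partitions of $n$ such that: all odd parts are blue (and may repeat); even parts may be of either color, but no even part is repeated within the same color; the smallest part is odd. Each such partition is counted with weight $(-1)^j$, where $j$ is the number of blue even parts. Equivalently, $\sum_{n\ge1}T_\nu(n)q^n=\sum_{n\ge0}\frac{q^{2n+1}(-q^{2n+2};q^2)_\infty(q^{2n+2};q^2)_\infty}{(q^{2n+1};q^2)_\infty}$. -}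

module Defs where

open import Data.Nat as ℕ using (ℕ; zero; suc)
open import Data.Integer as ℤ using (ℤ; +_; -_)
open import Data.List using (List; []; _∷_; map; concatMap; upTo; foldr; replicate; _++_)
open import Data.Bool using (Bool; true; false; not; _∧_; if_then_else_)
open import Data.Product using (_×_; _,_)

FPS : Set
FPS = ℕ → ℤ

sgn : ℕ → ℤ
sgn zero    = + 1
sgn (suc n) = - sgn n

negArg : FPS → FPS
negArg f m = sgn m ℤ.* f m

qTimes : FPS → FPS
qTimes f zero    = + 0
qTimes f (suc m) = f m

-- Polynomials over ℤ as coefficient lists (constant term first).

Poly : Set
Poly = List ℤ

coeff : ℕ → Poly → ℤ
coeff _       []       = + 0
coeff zero    (a ∷ _)  = a
coeff (suc i) (_ ∷ p)  = coeff i p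

_⊕_ : Poly → Poly → Poly
[]      ⊕ q       = q
p       ⊕ []      = p
(a ∷ p) ⊕ (b ∷ q) = (a ℤ.+ b) ∷ (p ⊕ q)

_⊗_ : Poly → Poly → Poly
[]      ⊗ q = []
(a ∷ p) ⊗ q = map (a ℤ.*_) q ⊕ (+ 0 ∷ (p ⊗ q))

mono : ℤ → ℕ → Poly
mono c k = replicate k (+ 0) ++ (c ∷ [])

prodP : List Poly → Poly
prodP = foldr _⊗_ (+ 1 ∷ [])

sumP : List Poly → Poly
sumP = foldr _⊕_ []

qPoch : ℕ → Poly
qPoch n = prodP (map (λ j → (+ 1 ∷ []) ⊕ mono (- + 1) (suc (2 ℕ.* j))) (upTo n))

νterm : ℕ → Poly
νterm n = mono (sgn n) n ⊗ qPoch n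

-- ν(q) = Σ_{n≥0} (-q)^n (q;q^2)_n as a formal power series.  The n-th
-- summand is divisible by q^n, so the coefficient of q^m only receives
-- contributions from n ≤ m.
ν : FPS
ν m = coeff m (sumP (map νterm (upTo (suc m))))

-- T_ν(n): signed count of restricted two-color partitions.
-- A two-color partition of n is encoded by its multiplicity list
--   [(b₁,g₁), (b₂,g₂), …, (bₙ,gₙ)]
-- where bₖ (resp. gₖ) is the number of blue (resp. green) parts equal to k.
-- All parts are ≤ n and all multiplicities ≤ n, so enumerating all such
-- lists of length n with entries in 0..n covers every two-color partition
-- of n exactly once.

isEven : ℕ → Bool
isEven zero    = true
isEven (suc k) = not (isEven k)

range : ℕ → List ℕ
range b = upTo (suc b)

multLists : ℕ → ℕ → List (List (ℕ × ℕ))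
multLists zero    b = [] ∷ []
multLists (suc l) b =
  concatMap (λ x → concatMap (λ y → map ((x , y) ∷_) (multLists l b)) (range b)) (range b)

sizeFrom : ℕ → List (ℕ × ℕ) → ℕ
sizeFrom k []             = 0
sizeFrom k ((b , g) ∷ ms) = k ℕ.* (b ℕ.+ g) ℕ.+ sizeFrom (suc k) ms

allowed : ℕ → List (ℕ × ℕ) → Bool
allowed k []             = true
allowed k ((b , g) ∷ ms) =
  (if isEven k then (b ℕ.≤ᵇ 1) ∧ (g ℕ.≤ᵇ 1) else (g ℕ.≡ᵇ 0)) ∧ allowed (suc k) ms

smallestOdd : ℕ → List (ℕ × ℕ) → Bool
smallestOdd k []             = false
smallestOdd k ((b , g) ∷ ms) =
  if (b ℕ.+ g) ℕ.≡ᵇ 0 then smallestOdd (suc k) ms else not (isEven k)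

blueEven : ℕ → List (ℕ × ℕ) → ℕ
blueEven k []             = 0
blueEven k ((b , g) ∷ ms) = (if isEven k then b else 0) ℕ.+ blueEven (suc k) ms

weight : ℕ → List (ℕ × ℕ) → ℤ
weight n ms =
  if (sizeFrom 1 ms ℕ.≡ᵇ n) ∧ allowed 1 ms ∧ smallestOdd 1 ms
  then sgn (blueEven 1 ms) else + 0

Tν : ℕ → ℤ
Tν n = foldr ℤ._+_ (+ 0) (map (weight n) (multLists n n))

Tseries : FPS
Tseries zero    = + 0
Tseries (suc n) = Tν (suc n)

module Submission where

-- Both sides are compared through the system
--   (1 - q^(2i+1)) X_i - q^(2i+2) X_(i+1) = 1        (i ≥ 0),
-- which has at most one solution, since the coefficient of q^m in a difference of two solutions
-- is a combination of lower coefficients.  ρ_i = Σ_n q^(n(2i+1)) (-q;q²)_n is a solution because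
-- (-q;q²)_(n+1) = (1 + q^(2n+1)) (-q;q²)_n, and ρ_0 = ν(-q).  So is
--   σ_i = Σ_n q^(2n) (q^(2n+2);q²)_∞ (-q^(2i+2n+2);q²)_∞ / (q^(2i+2n+1);q²)_∞,
-- because substituting it termwise into the left-hand side gives a telescoping sum.
-- Finally, sorting the partitions counted by T_ν by their smallest part 2n+1, that part contributes
-- q^(2n+1)/(1 - q^(2n+1)), every larger odd size j a factor 1/(1 - q^j) and every larger even size j
-- a factor (1 + q^j)(1 - q^j), so Σ T_ν(n) q^n = q σ_0.
-- All identities are proved coefficientwise up to a degree P, which allows infinite products and sums
-- to be truncated, and power series are manipulated through linear operators such as F ↦ (1 - q^e) F.

open import Defs
open import Data.Nat as ℕ using (ℕ; zero; suc; _≤_; _<_; z≤n; s≤s)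
open import Data.Nat.Induction using (<-rec)
import Data.Nat.Properties as ℕP
open import Data.Integer using (ℤ; +_; -_; _+_; _-_; _*_)
import Data.Integer.Properties as ℤP
open import Algebra.Properties.CommutativeSemigroup ℤP.+-commutativeSemigroup using (interchange)
open import Data.Integer.Tactic.RingSolver using (solve-∀)
import Data.Nat.Tactic.RingSolver as ℕSolver
open import Data.List using (List; []; _∷_; map; foldr; _++_; applyUpTo; upTo; concatMap)
open import Data.List.Properties using (map-∘; map-cong)
open import Data.Bool using (Bool; true; false; not; _∧_; if_then_else_)
open import Data.Bool.Properties using (∧-zeroʳ; ∧-identityʳ)
open import Data.Product using (_×_; _,_)
open import Data.Sum using (inj₁; inj₂)
open import Function using (_∘_; id)
open import Relation.Binary.Bundles using (Setoid)
open import Relation.Binary.PropositionalEquality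
import Relation.Binary.Reasoning.Setoid as SetoidReasoning

infixl 6 _⊞_ _⊟_
infixr 7 _·ˢ_
infix 4 _≈[_]_

_⊞_ : FPS → FPS → FPS
(F ⊞ G) m = F m + G m

_⊟_ : FPS → FPS → FPS
(F ⊟ G) m = F m - G m

_·ˢ_ : ℤ → FPS → FPS
(c ·ˢ F) m = c * F m

𝟘 : FPS
𝟘 _ = + 0

𝟙 : FPS
𝟙 zero    = + 1
𝟙 (suc _) = + 0

shift : ℕ → FPS → FPS
shift zero    F         = F
shift (suc e) F zero    = + 0
shift (suc e) F (suc m) = shift e F m

_≈[_]_ : FPS → ℕ → FPS → Set
F ≈[ P ] G = ∀ m → m ≤ P → F m ≡ G m

≗-setoid : Setoid _ _
≗-setoid = ℕ →-setoid ℤ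

open Setoid ≗-setoid using () renaming (refl to ≗-refl; sym to ≗-sym; trans to ≗-trans)
module ≗-Reasoning = SetoidReasoning ≗-setoid

≈-setoid : ℕ → Setoid _ _
≈-setoid P = record
  { Carrier       = FPS
  ; _≈_           = _≈[ P ]_
  ; isEquivalence = record
    { refl  = λ _ _ → refl
    ; sym   = λ p m m≤P → sym (p m m≤P)
    ; trans = λ p q m m≤P → trans (p m m≤P) (q m m≤P)
    }
  }

module _ {P : ℕ} where
  open Setoid (≈-setoid P) public using () renaming (refl to ≈-refl; sym to ≈-sym; trans to ≈-trans)

module ≈-Reasoning (P : ℕ) = SetoidReasoning (≈-setoid P)

≗⇒≈ : ∀ {P F G} → F ≗ G → F ≈[ P ] G
≗⇒≈ p m _ = p m

⊞-cong : ∀ {F F′ G G′} → F ≗ F′ → G ≗ G′ → F ⊞ G ≗ F′ ⊞ G′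
⊞-cong p q m = cong₂ _+_ (p m) (q m)

⊞-cong-≈ : ∀ {P F F′ G G′} → F ≈[ P ] F′ → G ≈[ P ] G′ → F ⊞ G ≈[ P ] F′ ⊞ G′
⊞-cong-≈ p q m m≤P = cong₂ _+_ (p m m≤P) (q m m≤P)

⊞-congʳ : ∀ F {G G′} → G ≗ G′ → F ⊞ G ≗ F ⊞ G′
⊞-congʳ F q m = cong (λ x → F m + x) (q m)

⊞-congʳ-≈ : ∀ {P} F {G G′} → G ≈[ P ] G′ → F ⊞ G ≈[ P ] F ⊞ G′
⊞-congʳ-≈ F q m m≤P = cong (λ x → F m + x) (q m m≤P)

⊟-cong : ∀ {F F′ G G′} → F ≗ F′ → G ≗ G′ → F ⊟ G ≗ F′ ⊟ G′
⊟-cong p q m = cong₂ _-_ (p m) (q m)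

⊟-cong-≈ : ∀ {P F F′ G G′} → F ≈[ P ] F′ → G ≈[ P ] G′ → F ⊟ G ≈[ P ] F′ ⊟ G′
⊟-cong-≈ p q m m≤P = cong₂ _-_ (p m m≤P) (q m m≤P)

−-interchange : ∀ a b c d → (a + b) - (c + d) ≡ (a - c) + (b - d)
−-interchange = solve-∀

⊟≗⊞-1·ˢ : ∀ F G → F ⊟ G ≗ F ⊞ (- + 1) ·ˢ G
⊟≗⊞-1·ˢ F G m = cong (λ x → F m + x) (sym (ℤP.-1*i≡-i (G m)))

𝟘≗0·ˢ : ∀ F → 𝟘 ≗ + 0 ·ˢ F
𝟘≗0·ˢ F m = refl

shift-cong : ∀ e {F G} → F ≗ G → shift e F ≗ shift e G
shift-cong zero    p m       = p m
shift-cong (suc e) p zero    = refl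
shift-cong (suc e) p (suc m) = shift-cong e p m

shift-cong-≈ : ∀ e {P F G} → F ≈[ P ] G → shift e F ≈[ P ] shift e G
shift-cong-≈ zero    p m       m≤P = p m m≤P
shift-cong-≈ (suc e) p zero    m≤P = refl
shift-cong-≈ (suc e) p (suc m) m≤P = shift-cong-≈ e p m (ℕP.≤-trans (ℕP.n≤1+n m) m≤P)

shift-⊞ : ∀ e F G → shift e (F ⊞ G) ≗ shift e F ⊞ shift e G
shift-⊞ zero    F G m       = refl
shift-⊞ (suc e) F G zero    = refl
shift-⊞ (suc e) F G (suc m) = shift-⊞ e F G m

shift-·ˢ : ∀ e c F → shift e (c ·ˢ F) ≗ c ·ˢ shift e F
shift-·ˢ zero    c F m       = refl
shift-·ˢ (suc e) c F zero    = sym (ℤP.*-zeroʳ c)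
shift-·ˢ (suc e) c F (suc m) = shift-·ˢ e c F m

shift-shift : ∀ a b F → shift a (shift b F) ≗ shift (a ℕ.+ b) F
shift-shift zero    b F m       = refl
shift-shift (suc a) b F zero    = refl
shift-shift (suc a) b F (suc m) = shift-shift a b F m

shift-vanishes : ∀ e F m → (∀ k → k ≤ m → F k ≡ + 0) → shift e F m ≡ + 0
shift-vanishes zero    F m       F≡0 = F≡0 m ℕP.≤-refl
shift-vanishes (suc e) F zero    F≡0 = refl
shift-vanishes (suc e) F (suc m) F≡0 = shift-vanishes e F m (λ k k≤m → F≡0 k (ℕP.m≤n⇒m≤1+n k≤m))

shift-below : ∀ e F m → m < e → shift e F m ≡ + 0
shift-below (suc e) F zero    _         = refl
shift-below (suc e) F (suc m) (s≤s m<e) = shift-below e F m m<e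

shift-≈𝟘 : ∀ {P e} F → P < e → shift e F ≈[ P ] 𝟘
shift-≈𝟘 {e = e} F P<e m m≤P = shift-below e F m (ℕP.≤-<-trans m≤P P<e)

Op : Set
Op = FPS → FPS

record Linear (T : Op) : Set where
  field
    cong-≈     : ∀ {P F G} → F ≈[ P ] G → T F ≈[ P ] T G
    ⊞-hom      : ∀ F G → T (F ⊞ G) ≗ T F ⊞ T G
    ·ˢ-hom     : ∀ c F → T (c ·ˢ F) ≗ c ·ˢ T F
    shift-comm : ∀ e F → T (shift e F) ≗ shift e (T F)

  cong-≗ : ∀ {F G} → F ≗ G → T F ≗ T G
  cong-≗ p m = cong-≈ (≗⇒≈ p) m ℕP.≤-refl

  ⊟-hom : ∀ F G → T (F ⊟ G) ≗ T F ⊟ T G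
  ⊟-hom F G = begin
    T (F ⊟ G)                    ≈⟨ cong-≗ (⊟≗⊞-1·ˢ F G) ⟩
    T (F ⊞ (- + 1) ·ˢ G)         ≈⟨ ⊞-hom F _ ⟩
    T F ⊞ T ((- + 1) ·ˢ G)       ≈⟨ ⊞-cong (≗-refl {T F}) (·ˢ-hom (- + 1) G) ⟩
    T F ⊞ (- + 1) ·ˢ T G         ≈⟨ ≗-sym (⊟≗⊞-1·ˢ (T F) (T G)) ⟩
    T F ⊟ T G                    ∎
    where open ≗-Reasoning

  𝟘-hom : T 𝟘 ≗ 𝟘
  𝟘-hom = begin
    T 𝟘              ≈⟨ cong-≗ (𝟘≗0·ˢ 𝟘) ⟩
    T (+ 0 ·ˢ 𝟘)     ≈⟨ ·ˢ-hom (+ 0) 𝟘 ⟩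
    + 0 ·ˢ T 𝟘       ≈⟨ ≗-sym (𝟘≗0·ˢ (T 𝟘)) ⟩
    𝟘                ∎
    where open ≗-Reasoning

open Linear

id-linear : Linear id
id-linear = record
  { cong-≈ = id ; ⊞-hom = λ _ _ _ → refl ; ·ˢ-hom = λ _ _ _ → refl ; shift-comm = λ _ _ _ → refl }

∘-linear : ∀ {T U} → Linear T → Linear U → Linear (T ∘ U)
∘-linear {T} {U} LT LU = record
  { cong-≈     = cong-≈ LT ∘ cong-≈ LU
  ; ⊞-hom      = λ F G → ≗-trans (cong-≗ LT (⊞-hom LU F G)) (⊞-hom LT (U F) (U G))
  ; ·ˢ-hom     = λ c F → ≗-trans (cong-≗ LT (·ˢ-hom LU c F)) (·ˢ-hom LT c (U F))
  ; shift-comm = λ e F → ≗-trans (cong-≗ LT (shift-comm LU e F)) (shift-comm LT e (U F))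
  }

shift-linear : ∀ e → Linear (shift e)
shift-linear e = record
  { cong-≈     = shift-cong-≈ e
  ; ⊞-hom      = shift-⊞ e
  ; ·ˢ-hom     = shift-·ˢ e
  ; shift-comm = λ a F m → begin
      shift e (shift a F) m   ≡⟨ shift-shift e a F m ⟩
      shift (e ℕ.+ a) F m     ≡⟨ cong (λ x → shift x F m) (ℕP.+-comm e a) ⟩
      shift (a ℕ.+ e) F m     ≡⟨ shift-shift a e F m ⟨
      shift a (shift e F) m   ∎
  }
  where open ≡-Reasoning

·ˢ-linear : ∀ c → Linear (c ·ˢ_)
·ˢ-linear c = record
  { cong-≈     = λ p m m≤P → cong (c *_) (p m m≤P)
  ; ⊞-hom      = λ F G m → ℤP.*-distribˡ-+ c (F m) (G m)
  ; ·ˢ-hom     = λ d F m → *-swap c d (F m)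
  ; shift-comm = λ e F → ≗-sym (shift-·ˢ e c F)
  }
  where
  *-swap : ∀ a b x → a * (b * x) ≡ b * (a * x)
  *-swap = solve-∀

⊞-linear : ∀ {T U} → Linear T → Linear U → Linear (λ F → T F ⊞ U F)
⊞-linear {T} {U} LT LU = record
  { cong-≈     = λ p → ⊞-cong-≈ (cong-≈ LT p) (cong-≈ LU p)
  ; ⊞-hom      = λ F G m → trans (cong₂ _+_ (⊞-hom LT F G m) (⊞-hom LU F G m))
                                 (interchange (T F m) (T G m) (U F m) (U G m))
  ; ·ˢ-hom     = λ c F m → trans (cong₂ _+_ (·ˢ-hom LT c F m) (·ˢ-hom LU c F m))
                                 (sym (ℤP.*-distribˡ-+ c (T F m) (U F m)))
  ; shift-comm = λ e F → ≗-trans (⊞-cong (shift-comm LT e F) (shift-comm LU e F))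
                                 (≗-sym (shift-⊞ e (T F) (U F)))
  }

⊟-linear : ∀ {T U} → Linear T → Linear U → Linear (λ F → T F ⊟ U F)
⊟-linear {T} {U} LT LU = record
  { cong-≈     = λ p → ⊟-cong-≈ (cong-≈ LT p) (cong-≈ LU p)
  ; ⊞-hom      = λ F G m → trans (cong₂ _-_ (⊞-hom LT F G m) (⊞-hom LU F G m))
                                 (−-interchange (T F m) (T G m) (U F m) (U G m))
  ; ·ˢ-hom     = λ c F m → trans (cong₂ _-_ (·ˢ-hom LT c F m) (·ˢ-hom LU c F m))
                                 (*-distribˡ-minus c (T F m) (U F m))
  ; shift-comm = λ e F → ≗-trans (⊟-cong (shift-comm LT e F) (shift-comm LU e F))
                                 (≗-sym (⊟-hom (shift-linear e) (T F) (U F)))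
  }
  where
  *-distribˡ-minus : ∀ c a b → c * a - c * b ≡ c * (a - b)
  *-distribˡ-minus = solve-∀

-- Commuting with every linear operator, rather than only with other multipliers, is what makes
-- multipliers closed under composition; it stands in for the commutativity of series multiplication.
record Multiplier (T : Op) : Set where
  field
    linear   : Linear T
    commutes : ∀ {U} → Linear U → ∀ F → T (U F) ≗ U (T F)

open Multiplier

swap : ∀ {T U} → Multiplier T → Multiplier U → ∀ F → T (U F) ≗ U (T F)
swap MT MU = commutes MT (linear MU)

id-multiplier : Multiplier id
id-multiplier = record { linear = id-linear ; commutes = λ _ _ _ → refl }

shift-multiplier : ∀ e → Multiplier (shift e)
shift-multiplier e = record
  { linear = shift-linear e ; commutes = λ LU F → ≗-sym (shift-comm LU e F) }

∘-multiplier : ∀ {T T′} → Multiplier T → Multiplier T′ → Multiplier (T ∘ T′)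
∘-multiplier {T} {T′} MT MT′ = record
  { linear   = ∘-linear (linear MT) (linear MT′)
  ; commutes = λ LU F → ≗-trans (cong-≗ (linear MT) (commutes MT′ LU F)) (commutes MT LU (T′ F))
  }

⊞-multiplier : ∀ {T T′} → Multiplier T → Multiplier T′ → Multiplier (λ F → T F ⊞ T′ F)
⊞-multiplier {T} {T′} MT MT′ = record
  { linear   = ⊞-linear (linear MT) (linear MT′)
  ; commutes = λ LU F → ≗-trans (⊞-cong (commutes MT LU F) (commutes MT′ LU F))
                                (≗-sym (⊞-hom LU (T F) (T′ F)))
  }

⊟-multiplier : ∀ {T T′} → Multiplier T → Multiplier T′ → Multiplier (λ F → T F ⊟ T′ F)
⊟-multiplier {T} {T′} MT MT′ = record
  { linear   = ⊟-linear (linear MT) (linear MT′)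
  ; commutes = λ LU F → ≗-trans (⊟-cong (commutes MT LU F) (commutes MT′ LU F))
                                (≗-sym (⊟-hom LU (T F) (T′ F)))
  }

1-q^ : ℕ → Op
1-q^ e F = F ⊟ shift e F

1+q^ : ℕ → Op
1+q^ e F = F ⊞ shift e F

geom : ℕ → ℕ → Op
geom e zero    F = F
geom e (suc b) F = F ⊞ shift e (geom e b F)

1-q^-multiplier : ∀ e → Multiplier (1-q^ e)
1-q^-multiplier e = ⊟-multiplier id-multiplier (shift-multiplier e)

1+q^-multiplier : ∀ e → Multiplier (1+q^ e)
1+q^-multiplier e = ⊞-multiplier id-multiplier (shift-multiplier e)

geom-multiplier : ∀ e b → Multiplier (geom e b)
geom-multiplier e zero    = id-multiplier
geom-multiplier e (suc b) =
  ⊞-multiplier id-multiplier (∘-multiplier (shift-multiplier e) (geom-multiplier e b))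

shift-shift-* : ∀ e b F → shift e (shift (e ℕ.* b) F) ≗ shift (e ℕ.* suc b) F
shift-shift-* e b F m = trans (shift-shift e (e ℕ.* b) F m) (cong (λ x → shift x F m) (sym (ℕP.*-suc e b)))

1-q^∘geom : ∀ e b F → 1-q^ e (geom e b F) ≗ F ⊟ shift (e ℕ.* suc b) F
1-q^∘geom e zero    F m = cong (λ x → F m - shift x F m) (sym (ℕP.*-identityʳ e))
1-q^∘geom e (suc b) F m = begin
  1-q^ e (F ⊞ shift e G) m
    ≡⟨ ⊞-hom L F (shift e G) m ⟩
  1-q^ e F m + 1-q^ e (shift e G) m
    ≡⟨ cong (λ x → 1-q^ e F m + x) (shift-comm L e G m) ⟩
  1-q^ e F m + shift e (1-q^ e G) m
    ≡⟨ cong (λ x → 1-q^ e F m + x) (shift-cong e (1-q^∘geom e b F) m) ⟩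
  1-q^ e F m + shift e (F ⊟ shift (e ℕ.* suc b) F) m
    ≡⟨ cong (λ x → 1-q^ e F m + x) (⊟-hom (shift-linear e) F _ m) ⟩
  (F m - shift e F m) + (shift e F m - shift e (shift (e ℕ.* suc b) F) m)
    ≡⟨ telescope (F m) (shift e F m) _ ⟩
  F m - shift e (shift (e ℕ.* suc b) F) m
    ≡⟨ cong (λ x → F m - x) (shift-shift-* e (suc b) F m) ⟩
  F m - shift (e ℕ.* suc (suc b)) F m
    ∎
  where
  open ≡-Reasoning
  G : FPS
  G = geom e b F
  L : Linear (1-q^ e)
  L = linear (1-q^-multiplier e)
  telescope : ∀ a b c → (a - b) + (b - c) ≡ a - c
  telescope = solve-∀

geom-suc : ∀ e b F → geom e (suc b) F ≗ geom e b F ⊞ shift (e ℕ.* suc b) F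
geom-suc e zero    F m = cong (λ x → F m + shift x F m) (sym (ℕP.*-identityʳ e))
geom-suc e (suc b) F m = begin
  F m + shift e (geom e (suc b) F) m
    ≡⟨ cong (λ x → F m + x) (shift-cong e (geom-suc e b F) m) ⟩
  F m + shift e (geom e b F ⊞ shift (e ℕ.* suc b) F) m
    ≡⟨ cong (λ x → F m + x) (shift-⊞ e _ _ m) ⟩
  F m + (shift e (geom e b F) m + shift e (shift (e ℕ.* suc b) F) m)
    ≡⟨ ℤP.+-assoc (F m) _ _ ⟨
  F m + shift e (geom e b F) m + shift e (shift (e ℕ.* suc b) F) m
    ≡⟨ cong (λ x → F m + shift e (geom e b F) m + x) (shift-shift-* e (suc b) F m) ⟩
  F m + shift e (geom e b F) m + shift (e ℕ.* suc (suc b)) F m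
    ∎
  where open ≡-Reasoning

1-q^∘1+q^ : ∀ e F → 1-q^ e (1+q^ e F) ≗ 1-q^ (e ℕ.+ e) F
1-q^∘1+q^ e F m = begin
  (F m + shift e F m) - shift e (F ⊞ shift e F) m
    ≡⟨ cong (λ x → (F m + shift e F m) - x) (shift-⊞ e F _ m) ⟩
  (F m + shift e F m) - (shift e F m + shift e (shift e F) m)
    ≡⟨ cancel (F m) (shift e F m) _ ⟩
  F m - shift e (shift e F) m
    ≡⟨ cong (λ x → F m - x) (shift-shift e e F m) ⟩
  F m - shift (e ℕ.+ e) F m
    ∎
  where
  open ≡-Reasoning
  cancel : ∀ a b c → (a + b) - (b + c) ≡ a - c
  cancel = solve-∀

IsIdUpTo : ℕ → Op → Set
IsIdUpTo P T = ∀ F → T F ≈[ P ] F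

1-q^-idUpTo : ∀ {P e} → P < e → IsIdUpTo P (1-q^ e)
1-q^-idUpTo P<e F m m≤P = trans (cong (λ x → F m - x) (shift-≈𝟘 F P<e m m≤P)) (ℤP.+-identityʳ (F m))

1+q^-idUpTo : ∀ {P e} → P < e → IsIdUpTo P (1+q^ e)
1+q^-idUpTo P<e F m m≤P = trans (cong (λ x → F m + x) (shift-≈𝟘 F P<e m m≤P)) (ℤP.+-identityʳ (F m))

geom-idUpTo : ∀ {P e} b → P < e → IsIdUpTo P (geom e b)
geom-idUpTo zero    P<e F m m≤P = refl
geom-idUpTo (suc b) P<e F m m≤P = trans (cong (λ x → F m + x) (shift-≈𝟘 _ P<e m m≤P)) (ℤP.+-identityʳ (F m))

∘-idUpTo : ∀ {P T U} → Linear T → IsIdUpTo P T → IsIdUpTo P U → IsIdUpTo P (T ∘ U)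
∘-idUpTo LT T≈id U≈id F = ≈-trans (cong-≈ LT (U≈id F)) (T≈id F)

1-q^∘geom-idUpTo : ∀ {P} e b → P < e ℕ.* suc b → IsIdUpTo P (1-q^ e ∘ geom e b)
1-q^∘geom-idUpTo e b P<e*b F m m≤P =
  trans (1-q^∘geom e b F m) (trans (cong (λ x → F m - x) (shift-≈𝟘 F P<e*b m m≤P)) (ℤP.+-identityʳ (F m)))

IdUpToFrom : ℕ → (ℕ → Op) → ℕ → Set
IdUpToFrom P φ n = ∀ j → n ≤ j → IsIdUpTo P (φ j)

prodOp : (ℕ → Op) → ℕ → ℕ → Op
prodOp φ c zero    F = F
prodOp φ c (suc L) F = φ c (prodOp φ (suc c) L F)

module _ {φ : ℕ → Op} (Mφ : ∀ j → Multiplier (φ j)) where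

  prodOp-multiplier : ∀ c L → Multiplier (prodOp φ c L)
  prodOp-multiplier c zero    = id-multiplier
  prodOp-multiplier c (suc L) = ∘-multiplier (Mφ c) (prodOp-multiplier (suc c) L)

  prodOp-idUpTo : ∀ {P} c L → IdUpToFrom P φ c → IsIdUpTo P (prodOp φ c L)
  prodOp-idUpTo c zero    _    F = ≈-refl
  prodOp-idUpTo c (suc L) φ≈id F =
    ∘-idUpTo (linear (Mφ c)) (φ≈id c ℕP.≤-refl)
             (prodOp-idUpTo (suc c) L (λ j c<j → φ≈id j (ℕP.<⇒≤ c<j))) F

  prodOp-extend : ∀ {P} c {L L′} → L ≤ L′ → IdUpToFrom P φ (c ℕ.+ L) →
                  ∀ F → prodOp φ c L F ≈[ P ] prodOp φ c L′ F
  prodOp-extend c {zero} {L′} z≤n φ≈id F =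
    ≈-sym (prodOp-idUpTo c L′ (λ j c≤j → φ≈id j (subst (_≤ j) (sym (ℕP.+-identityʳ c)) c≤j)) F)
  prodOp-extend c {suc L} {suc L′} (s≤s L≤L′) φ≈id F =
    cong-≈ (linear (Mφ c))
           (prodOp-extend (suc c) L≤L′ (λ j h → φ≈id j (subst (_≤ j) (sym (ℕP.+-suc c L)) h)) F)

  prodOp-stable : ∀ {P} c L L′ → IdUpToFrom P φ (c ℕ.+ L) → IdUpToFrom P φ (c ℕ.+ L′) →
                  ∀ F → prodOp φ c L F ≈[ P ] prodOp φ c L′ F
  prodOp-stable c L L′ φ≈id φ≈id′ F with ℕP.≤-total L L′
  ... | inj₁ L≤L′ = prodOp-extend c L≤L′ φ≈id F
  ... | inj₂ L′≤L = ≈-sym (prodOp-extend c L′≤L φ≈id′ F)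

  prodOp-interleave : ∀ {ψ : ℕ → Op} → (∀ j → Multiplier (ψ j)) → ∀ c L F →
                      prodOp φ c L (prodOp ψ c L F) ≗ prodOp (λ j → φ j ∘ ψ j) c L F
  prodOp-interleave Mψ c zero    F = ≗-refl
  prodOp-interleave Mψ c (suc L) F =
    cong-≗ (linear (Mφ c)) (≗-trans (swap (prodOp-multiplier (suc c) L) (Mψ c) _)
                                    (cong-≗ (linear (Mψ c)) (prodOp-interleave Mψ (suc c) L F)))

prodOp-cong : ∀ {φ ψ} → (∀ j → Linear (ψ j)) → (∀ j F → φ j F ≗ ψ j F) →
              ∀ c L F → prodOp φ c L F ≗ prodOp ψ c L F
prodOp-cong Lψ φ≗ψ c zero    F = ≗-refl
prodOp-cong Lψ φ≗ψ c (suc L) F = ≗-trans (φ≗ψ c _) (cong-≗ (Lψ c) (prodOp-cong Lψ φ≗ψ (suc c) L F))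

prodOp-snoc : ∀ φ c L F → prodOp φ c (suc L) F ≡ prodOp φ c L (φ (c ℕ.+ L) F)
prodOp-snoc φ c zero    F = cong (λ x → φ x F) (sym (ℕP.+-identityʳ c))
prodOp-snoc φ c (suc L) F = cong (φ c) (trans (prodOp-snoc φ (suc c) L F)
                                               (cong (λ x → prodOp φ (suc c) L (φ x F)) (sym (ℕP.+-suc c L))))

prodOp-suc : ∀ φ c L F → prodOp φ (suc c) L F ≡ prodOp (φ ∘ suc) c L F
prodOp-suc φ c zero    F = refl
prodOp-suc φ c (suc L) F = cong (φ (suc c)) (prodOp-suc φ (suc c) L F)

sumFrom : (ℕ → FPS) → ℕ → ℕ → FPS
sumFrom X t zero    = 𝟘
sumFrom X t (suc c) = X t ⊞ sumFrom X (suc t) c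

sumFrom-cong : ∀ {X Y} → (∀ n → X n ≗ Y n) → ∀ t c → sumFrom X t c ≗ sumFrom Y t c
sumFrom-cong X≗Y t zero    = ≗-refl
sumFrom-cong X≗Y t (suc c) = ⊞-cong (X≗Y t) (sumFrom-cong X≗Y (suc t) c)

sumFrom-cong-≈ : ∀ {P X Y} → (∀ n → X n ≈[ P ] Y n) → ∀ t c → sumFrom X t c ≈[ P ] sumFrom Y t c
sumFrom-cong-≈ X≈Y t zero    = ≈-refl
sumFrom-cong-≈ X≈Y t (suc c) = ⊞-cong-≈ (X≈Y t) (sumFrom-cong-≈ X≈Y (suc t) c)

sumFrom-suc : ∀ X t c → sumFrom X (suc t) c ≗ sumFrom (X ∘ suc) t c
sumFrom-suc X t zero    = ≗-refl
sumFrom-suc X t (suc c) = ⊞-congʳ (X (suc t)) (sumFrom-suc X (suc t) c)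

sumFrom-hom : ∀ {T} → Linear T → ∀ X t c → T (sumFrom X t c) ≗ sumFrom (T ∘ X) t c
sumFrom-hom LT X t zero    = 𝟘-hom LT
sumFrom-hom {T} LT X t (suc c) = ≗-trans (⊞-hom LT (X t) _) (⊞-congʳ (T (X t)) (sumFrom-hom LT X (suc t) c))

sumFrom-⊞ : ∀ X Y t c → sumFrom (λ n → X n ⊞ Y n) t c ≗ sumFrom X t c ⊞ sumFrom Y t c
sumFrom-⊞ X Y t zero    m = refl
sumFrom-⊞ X Y t (suc c) m =
  trans (cong (λ x → (X t m + Y t m) + x) (sumFrom-⊞ X Y (suc t) c m))
        (interchange (X t m) (Y t m) _ _)

sumFrom-⊟ : ∀ X Y t c → sumFrom X t c ⊟ sumFrom Y t c ≗ sumFrom (λ n → X n ⊟ Y n) t c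
sumFrom-⊟ X Y t zero    m = refl
sumFrom-⊟ X Y t (suc c) m =
  trans (−-interchange (X t m) _ (Y t m) _) (cong (λ x → (X t m - Y t m) + x) (sumFrom-⊟ X Y (suc t) c m))

sumFrom-telescope : ∀ (T : ℕ → FPS) t c → sumFrom (λ n → T (suc n) ⊟ T n) t c ≗ T (t ℕ.+ c) ⊟ T t
sumFrom-telescope T t zero    m =
  trans (sym (ℤP.+-inverseʳ (T t m))) (cong (λ x → T x m - T t m) (sym (ℕP.+-identityʳ t)))
sumFrom-telescope T t (suc c) m = begin
  (T (suc t) m - T t m) + sumFrom (λ n → T (suc n) ⊟ T n) (suc t) c m
      ≡⟨ cong (λ x → (T (suc t) m - T t m) + x) (sumFrom-telescope T (suc t) c m) ⟩
  (T (suc t) m - T t m) + (T (suc t ℕ.+ c) m - T (suc t) m)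
      ≡⟨ collapse (T (suc t) m) (T t m) (T (suc t ℕ.+ c) m) ⟩
  T (suc t ℕ.+ c) m - T t m
      ≡⟨ cong (λ x → T x m - T t m) (sym (ℕP.+-suc t c)) ⟩
  T (t ℕ.+ suc c) m - T t m
      ∎
  where
  open ≡-Reasoning
  collapse : ∀ a b c → (a - b) + (c - a) ≡ c - b
  collapse = solve-∀

sumFrom-≈𝟘 : ∀ {P} X t c → (∀ n → t ≤ n → X n ≈[ P ] 𝟘) → sumFrom X t c ≈[ P ] 𝟘
sumFrom-≈𝟘 X t zero    X≈0 = ≈-refl
sumFrom-≈𝟘 X t (suc c) X≈0 m m≤P =
  cong₂ _+_ (X≈0 t ℕP.≤-refl m m≤P) (sumFrom-≈𝟘 X (suc t) c (λ n t<n → X≈0 n (ℕP.<⇒≤ t<n)) m m≤P)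

sumFrom-extend : ∀ {P} X t {c c′} → c ≤ c′ → (∀ n → t ℕ.+ c ≤ n → X n ≈[ P ] 𝟘) →
                 sumFrom X t c ≈[ P ] sumFrom X t c′
sumFrom-extend X t {zero} {c′} z≤n X≈0 =
  ≈-sym (sumFrom-≈𝟘 X t c′ (λ n t≤n → X≈0 n (subst (_≤ n) (sym (ℕP.+-identityʳ t)) t≤n)))
sumFrom-extend X t {suc c} {suc c′} (s≤s c≤c′) X≈0 =
  ⊞-congʳ-≈ (X t) (sumFrom-extend X (suc t) c≤c′ (λ n h → X≈0 n (subst (_≤ n) (sym (ℕP.+-suc t c)) h)))

odd : ℕ → ℕ
odd u = suc (u ℕ.+ u)

SolvesRecurrence : ℕ → (ℕ → FPS) → Set
SolvesRecurrence P X = ∀ i → 1-q^ (odd i) (X i) ⊟ shift (suc (odd i)) (X (suc i)) ≈[ P ] 𝟙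

shift-suc-vanishes : ∀ e F m → (∀ k → k < m → F k ≡ + 0) → shift (suc e) F m ≡ + 0
shift-suc-vanishes e F zero    _   = refl
shift-suc-vanishes e F (suc m) F≡0 = shift-vanishes e F m (λ k k≤m → F≡0 k (s≤s k≤m))

recurrence-unique : ∀ {P} X Y → SolvesRecurrence P X → SolvesRecurrence P Y → ∀ i → X i ≈[ P ] Y i
recurrence-unique {P} X Y X-rec Y-rec i m m≤P = ℤP.i-j≡0⇒i≡j (X i m) (Y i m) (D≡0 m m≤P i)
  where
  D : ℕ → FPS
  D i = X i ⊟ Y i

  rearrange : ∀ a b c a′ b′ c′ → a - a′ ≡ (((a - b) - c) - ((a′ - b′) - c′)) + ((b - b′) + (c - c′))
  rearrange = solve-∀

  D-rec : ∀ i m → m ≤ P → D i m ≡ shift (odd i) (D i) m + shift (suc (odd i)) (D (suc i)) m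
  D-rec i m m≤P = begin
    X i m - Y i m
      ≡⟨ rearrange (X i m) sX sX′ (Y i m) sY sY′ ⟩
    (((X i m - sX) - sX′) - ((Y i m - sY) - sY′)) + rest
      ≡⟨ cong (_+ rest) (cong₂ _-_ (X-rec i m m≤P) (Y-rec i m m≤P)) ⟩
    (𝟙 m - 𝟙 m) + rest
      ≡⟨ trans (cong (_+ rest) (ℤP.+-inverseʳ (𝟙 m))) (ℤP.+-identityˡ rest) ⟩
    rest
      ≡⟨ cong₂ _+_ (⊟-hom (shift-linear (odd i)) (X i) (Y i) m)
                   (⊟-hom (shift-linear (suc (odd i))) (X (suc i)) (Y (suc i)) m) ⟨
    shift (odd i) (D i) m + shift (suc (odd i)) (D (suc i)) m
      ∎
    where
    open ≡-Reasoning
    sX sX′ sY sY′ rest : ℤ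
    sX   = shift (odd i) (X i) m
    sX′  = shift (suc (odd i)) (X (suc i)) m
    sY   = shift (odd i) (Y i) m
    sY′  = shift (suc (odd i)) (Y (suc i)) m
    rest = (sX - sY) + (sX′ - sY′)

  D≡0 : ∀ m → m ≤ P → ∀ i → D i m ≡ + 0
  D≡0 = <-rec _ λ m ih m≤P i →
    let below : ∀ j k → k < m → D j k ≡ + 0
        below j k k<m = ih k<m (ℕP.<⇒≤ (ℕP.<-≤-trans k<m m≤P)) j
    in trans (D-rec i m m≤P) (cong₂ _+_ (shift-suc-vanishes (i ℕ.+ i) (D i) m (below i))
                                        (shift-suc-vanishes (odd i) (D (suc i)) m (below (suc i))))

negQPoch : ℕ → FPS
negQPoch n = prodOp (1+q^ ∘ odd) 0 n 𝟙

negQPoch-suc : ∀ n → negQPoch (suc n) ≗ 1+q^ (odd n) (negQPoch n)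
negQPoch-suc n m =
  trans (cong (λ G → G m) (prodOp-snoc (1+q^ ∘ odd) 0 n 𝟙))
        (swap (prodOp-multiplier (1+q^-multiplier ∘ odd) 0 n) (1+q^-multiplier (odd n)) 𝟙 m)

-- ρ i and σ i are the series ρ_i and σ_i, with B n = (q^(2n+2);q²)_∞ and
-- K c = (-q^(2c+2);q²)_∞ / (q^(2c+1);q²)_∞.
-- Products keep L factors and sums N terms: up to degree P the omitted factors act as the identity
-- and the omitted terms vanish.
module Families (P : ℕ) where

  L N : ℕ
  L = suc P
  N = suc (suc P)

  ρTerm : ℕ → ℕ → FPS
  ρTerm i n = shift (n ℕ.* odd i) (negQPoch n)

  ρ : ℕ → FPS
  ρ i = sumFrom (ρTerm i) 0 N

  ρTerm-suc : ∀ i n → ρTerm i (suc n) ≗ shift (odd i) (ρTerm i n) ⊞ shift (suc (odd i)) (ρTerm (suc i) n)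
  ρTerm-suc i n = begin
    shift (suc n ℕ.* odd i) (negQPoch (suc n))
      ≈⟨ shift-cong (suc n ℕ.* odd i) (negQPoch-suc n) ⟩
    shift (suc n ℕ.* odd i) (negQPoch n ⊞ shift (odd n) (negQPoch n))
      ≈⟨ shift-⊞ (suc n ℕ.* odd i) _ _ ⟩
    shift (suc n ℕ.* odd i) (negQPoch n) ⊞ shift (suc n ℕ.* odd i) (shift (odd n) (negQPoch n))
      ≈⟨ ⊞-cong (≗-sym (shift-shift (odd i) (n ℕ.* odd i) (negQPoch n)))
                (≗-trans (shift-shift (suc n ℕ.* odd i) (odd n) (negQPoch n))
                 (≗-trans (λ m → cong (λ e → shift e (negQPoch n) m) (exponents i n))
                          (≗-sym (shift-shift (suc (odd i)) (n ℕ.* odd (suc i)) (negQPoch n))))) ⟩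
    shift (odd i) (ρTerm i n) ⊞ shift (suc (odd i)) (ρTerm (suc i) n)
      ∎
    where
    open ≗-Reasoning
    exponents : ∀ i n → (suc (i ℕ.+ i) ℕ.+ n ℕ.* suc (i ℕ.+ i)) ℕ.+ suc (n ℕ.+ n)
                      ≡ suc (suc (i ℕ.+ i)) ℕ.+ n ℕ.* suc (suc i ℕ.+ suc i)
    exponents = ℕSolver.solve-∀

  ρ-truncate : ∀ i → sumFrom (ρTerm i) 0 L ≈[ P ] ρ i
  ρ-truncate i = sumFrom-extend (ρTerm i) 0 (ℕP.n≤1+n L)
    (λ n L≤n → shift-≈𝟘 (negQPoch n) (ℕP.≤-trans L≤n (ℕP.m≤m*n n (odd i))))

  ρ-expand : ∀ i → ρ i ≈[ P ] 𝟙 ⊞ (shift (odd i) (ρ i) ⊞ shift (suc (odd i)) (ρ (suc i)))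
  ρ-expand i = ⊞-congʳ-≈ 𝟙 (begin
    sumFrom (ρTerm i) 1 L
      ≈⟨ ≗⇒≈ (sumFrom-suc (ρTerm i) 0 L) ⟩
    sumFrom (ρTerm i ∘ suc) 0 L
      ≈⟨ ≗⇒≈ (sumFrom-cong (ρTerm-suc i) 0 L) ⟩
    sumFrom (λ n → shift (odd i) (ρTerm i n) ⊞ shift (suc (odd i)) (ρTerm (suc i) n)) 0 L
      ≈⟨ ≗⇒≈ (sumFrom-⊞ (shift (odd i) ∘ ρTerm i) (shift (suc (odd i)) ∘ ρTerm (suc i)) 0 L) ⟩
    sumFrom (shift (odd i) ∘ ρTerm i) 0 L ⊞ sumFrom (shift (suc (odd i)) ∘ ρTerm (suc i)) 0 L
      ≈⟨ ≗⇒≈ (≗-sym (⊞-cong (sumFrom-hom (shift-linear (odd i)) (ρTerm i) 0 L)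
                            (sumFrom-hom (shift-linear (suc (odd i))) (ρTerm (suc i)) 0 L))) ⟩
    shift (odd i) (sumFrom (ρTerm i) 0 L) ⊞ shift (suc (odd i)) (sumFrom (ρTerm (suc i)) 0 L)
      ≈⟨ ⊞-cong-≈ (shift-cong-≈ (odd i) (ρ-truncate i)) (shift-cong-≈ (suc (odd i)) (ρ-truncate (suc i))) ⟩
    shift (odd i) (ρ i) ⊞ shift (suc (odd i)) (ρ (suc i))
      ∎)
    where open ≈-Reasoning P

  ρ-solves : SolvesRecurrence P ρ
  ρ-solves i m m≤P = begin
    (ρ i m - shift (odd i) (ρ i) m) - shift (suc (odd i)) (ρ (suc i)) m
      ≡⟨ cong (λ x → (x - shift (odd i) (ρ i) m) - shift (suc (odd i)) (ρ (suc i)) m) (ρ-expand i m m≤P) ⟩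
    ((𝟙 m + (shift (odd i) (ρ i) m + shift (suc (odd i)) (ρ (suc i)) m)) - shift (odd i) (ρ i) m)
      - shift (suc (odd i)) (ρ (suc i)) m
      ≡⟨ cancel (𝟙 m) (shift (odd i) (ρ i) m) (shift (suc (odd i)) (ρ (suc i)) m) ⟩
    𝟙 m
      ∎
    where
    open ≡-Reasoning
    cancel : ∀ d a b → ((d + (a + b)) - a) - b ≡ d
    cancel = solve-∀

  evenMinus : ℕ → Op
  evenMinus u = 1-q^ (suc (odd u))

  -- geom (odd u) P agrees with 1/(1 - q^(2u+1)) up to degree P.
  ratio : ℕ → Op
  ratio u F = geom (odd u) P (1+q^ (suc (odd u)) F)

  evenMinus-multiplier : ∀ u → Multiplier (evenMinus u)
  evenMinus-multiplier u = 1-q^-multiplier (suc (odd u))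

  ratio-multiplier : ∀ u → Multiplier (ratio u)
  ratio-multiplier u = ∘-multiplier (geom-multiplier (odd u) P) (1+q^-multiplier (suc (odd u)))

  P<odd : ∀ u → P < u → P < odd u
  P<odd u P<u = ℕP.≤-trans P<u (ℕP.≤-trans (ℕP.m≤m+n u u) (ℕP.n≤1+n _))

  evenMinus-idUpTo : ∀ u → P < u → IsIdUpTo P (evenMinus u)
  evenMinus-idUpTo u P<u = 1-q^-idUpTo (ℕP.m≤n⇒m≤1+n (P<odd u P<u))

  ratio-idUpTo : ∀ u → P < u → IsIdUpTo P (ratio u)
  ratio-idUpTo u P<u = ∘-idUpTo (linear (geom-multiplier (odd u) P)) (geom-idUpTo P (P<odd u P<u))
                                (1+q^-idUpTo (ℕP.m≤n⇒m≤1+n (P<odd u P<u)))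

  B : ℕ → Op
  B n = prodOp evenMinus n L

  K : ℕ → Op
  K c = prodOp ratio c L

  B-multiplier : ∀ n → Multiplier (B n)
  B-multiplier n = prodOp-multiplier evenMinus-multiplier n L

  P<beyond : ∀ c j → c ℕ.+ L ≤ j → P < j
  P<beyond c j c+L≤j = ℕP.≤-trans (ℕP.m≤n+m L c) c+L≤j

  B-unfold : ∀ n F → B n F ≈[ P ] evenMinus n (B (suc n) F)
  B-unfold n = prodOp-extend evenMinus-multiplier n (ℕP.n≤1+n L) (λ j h → evenMinus-idUpTo j (P<beyond n j h))

  K-unfold : ∀ c F → K c F ≈[ P ] ratio c (K (suc c) F)
  K-unfold c = prodOp-extend ratio-multiplier c (ℕP.n≤1+n L) (λ j h → ratio-idUpTo j (P<beyond c j h))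

  σTerm : ℕ → ℕ → FPS
  σTerm i n = shift (n ℕ.+ n) (B n (K (i ℕ.+ n) 𝟙))

  σ : ℕ → FPS
  σ i = sumFrom (σTerm i) 0 N

  telescopeTerm : ℕ → ℕ → FPS
  telescopeTerm i n = 1-q^ (n ℕ.+ n) (B n (K (i ℕ.+ n) 𝟙))

  ratio-cancel : ∀ n c → 1-q^ (odd c) (B n (K c 𝟙)) ≈[ P ] 1+q^ (suc (odd c)) (B n (K (suc c) 𝟙))
  ratio-cancel n c = begin
    1-q^ (odd c) (B n (K c 𝟙))
      ≈⟨ cong-≈ (linear (∘-multiplier (1-q^-multiplier (odd c)) (B-multiplier n))) (K-unfold c 𝟙) ⟩
    1-q^ (odd c) (B n (ratio c (K (suc c) 𝟙)))
      ≈⟨ ≗⇒≈ (cong-≗ (linear (1-q^-multiplier (odd c))) (swap (B-multiplier n) (ratio-multiplier c) _)) ⟩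
    1-q^ (odd c) (geom (odd c) P (1+q^ (suc (odd c)) (B n (K (suc c) 𝟙))))
      ≈⟨ 1-q^∘geom-idUpTo (odd c) P (ℕP.m≤n*m L (odd c)) _ ⟩
    1+q^ (suc (odd c)) (B n (K (suc c) 𝟙))
      ∎
    where open ≈-Reasoning P

  telescopeTerm-suc : ∀ i n → B n (K (suc (i ℕ.+ n)) 𝟙) ≈[ P ] telescopeTerm i (suc n)
  telescopeTerm-suc i n = ≈-trans (B-unfold n _) (≗⇒≈ λ m →
    cong₂ (λ e c → 1-q^ e (B (suc n) (K c 𝟙)) m) (cong suc (sym (ℕP.+-suc n n))) (sym (ℕP.+-suc i n)))

  σTerm-step : ∀ i n → 1-q^ (odd i) (σTerm i n) ⊟ shift (suc (odd i)) (σTerm (suc i) n)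
                       ≈[ P ] telescopeTerm i (suc n) ⊟ telescopeTerm i n
  σTerm-step i n m m≤P = begin
    (a - shift (odd i) (shift (n ℕ.+ n) V) m) - shift (suc (odd i)) (shift (n ℕ.+ n) Y) m
      ≡⟨ cong₂ (λ x y → (a - x) - y) (merge 0 V) (merge 1 Y) ⟩
    (a - shift w V m) - shift (suc w) Y m
      ≡⟨ substitute a (V m) (shift w V m) (Y m) (shift (suc w) Y m) (ratio-cancel n c m m≤P) ⟩
    Y m - telescopeTerm i n m
      ≡⟨ cong (_- telescopeTerm i n m) (telescopeTerm-suc i n m m≤P) ⟩
    telescopeTerm i (suc n) m - telescopeTerm i n m
      ∎
    where
    open ≡-Reasoning
    c w : ℕ
    c = i ℕ.+ n
    w = odd c
    V Y : FPS
    V = B n (K c 𝟙)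
    Y = B n (K (suc c) 𝟙)
    a : ℤ
    a = shift (n ℕ.+ n) V m
    exponent : ∀ d i n → (d ℕ.+ suc (i ℕ.+ i)) ℕ.+ (n ℕ.+ n) ≡ d ℕ.+ suc ((i ℕ.+ n) ℕ.+ (i ℕ.+ n))
    exponent = ℕSolver.solve-∀
    merge : ∀ d F → shift (d ℕ.+ odd i) (shift (n ℕ.+ n) F) m ≡ shift (d ℕ.+ w) F m
    merge d F = trans (shift-shift (d ℕ.+ odd i) (n ℕ.+ n) F m) (cong (λ e → shift e F m) (exponent d i n))
    regroup : ∀ a v sv y sy → (a - sv) - sy ≡ (y - (v - a)) + ((v - sv) - (y + sy))
    regroup = solve-∀
    substitute : ∀ a v sv y sy → v - sv ≡ y + sy → (a - sv) - sy ≡ y - (v - a)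
    substitute a v sv y sy eq = begin
      (a - sv) - sy                              ≡⟨ regroup a v sv y sy ⟩
      (y - (v - a)) + ((v - sv) - (y + sy))      ≡⟨ cong (λ x → (y - (v - a)) + (x - (y + sy))) eq ⟩
      (y - (v - a)) + ((y + sy) - (y + sy))      ≡⟨ cong (λ x → (y - (v - a)) + x) (ℤP.+-inverseʳ (y + sy)) ⟩
      (y - (v - a)) + + 0                        ≡⟨ ℤP.+-identityʳ _ ⟩
      y - (v - a)                                ∎

  telescopeTerm-zero : ∀ i → telescopeTerm i 0 ≗ 𝟘
  telescopeTerm-zero i m = ℤP.+-inverseʳ (B 0 (K (i ℕ.+ 0) 𝟙) m)

  telescopeTerm-N : ∀ i → telescopeTerm i N ≈[ P ] 𝟙
  telescopeTerm-N i =
    ∘-idUpTo (linear (1-q^-multiplier (N ℕ.+ N))) (1-q^-idUpTo (ℕP.≤-trans (ℕP.n≤1+n L) (ℕP.m≤m+n N N)))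
      (∘-idUpTo (linear (B-multiplier N))
        (prodOp-idUpTo evenMinus-multiplier N L (λ j N≤j → evenMinus-idUpTo j (ℕP.<⇒≤ N≤j)))
        (prodOp-idUpTo ratio-multiplier (i ℕ.+ N) L
          (λ j i+N≤j → ratio-idUpTo j (ℕP.<⇒≤ (ℕP.≤-trans (ℕP.m≤n+m N i) i+N≤j)))))
      𝟙

  σ-solves : SolvesRecurrence P σ
  σ-solves i = begin
    1-q^ (odd i) (σ i) ⊟ shift (suc (odd i)) (σ (suc i))
      ≈⟨ ≗⇒≈ (⊟-cong (sumFrom-hom (linear (1-q^-multiplier (odd i))) (σTerm i) 0 N)
                     (sumFrom-hom (shift-linear (suc (odd i))) (σTerm (suc i)) 0 N)) ⟩
    sumFrom (1-q^ (odd i) ∘ σTerm i) 0 N ⊟ sumFrom (shift (suc (odd i)) ∘ σTerm (suc i)) 0 N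
      ≈⟨ ≗⇒≈ (sumFrom-⊟ (1-q^ (odd i) ∘ σTerm i) (shift (suc (odd i)) ∘ σTerm (suc i)) 0 N) ⟩
    sumFrom (λ n → 1-q^ (odd i) (σTerm i n) ⊟ shift (suc (odd i)) (σTerm (suc i) n)) 0 N
      ≈⟨ sumFrom-cong-≈ (σTerm-step i) 0 N ⟩
    sumFrom (λ n → telescopeTerm i (suc n) ⊟ telescopeTerm i n) 0 N
      ≈⟨ ≗⇒≈ (sumFrom-telescope (telescopeTerm i) 0 N) ⟩
    telescopeTerm i N ⊟ telescopeTerm i 0
      ≈⟨ ⊟-cong-≈ (telescopeTerm-N i) (≗⇒≈ (telescopeTerm-zero i)) ⟩
    𝟙 ⊟ 𝟘
      ≈⟨ ≗⇒≈ (λ m → ℤP.+-identityʳ (𝟙 m)) ⟩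
    𝟙
      ∎
    where open ≈-Reasoning P

  σ≈ρ : σ 0 ≈[ P ] ρ 0
  σ≈ρ = recurrence-unique σ ρ σ-solves ρ-solves 0

coeffs : Poly → FPS
coeffs p m = coeff m p

mulPoly : Poly → Op
mulPoly []      F = 𝟘
mulPoly (a ∷ p) F = a ·ˢ F ⊞ shift 1 (mulPoly p F)

coeffs-⊕ : ∀ p q → coeffs (p ⊕ q) ≗ coeffs p ⊞ coeffs q
coeffs-⊕ []      q       m       = sym (ℤP.+-identityˡ _)
coeffs-⊕ (a ∷ p) []      m       = sym (ℤP.+-identityʳ _)
coeffs-⊕ (a ∷ p) (b ∷ q) zero    = refl
coeffs-⊕ (a ∷ p) (b ∷ q) (suc m) = coeffs-⊕ p q m

coeffs-map-* : ∀ a q → coeffs (map (a *_) q) ≗ a ·ˢ coeffs q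
coeffs-map-* a []      m       = sym (ℤP.*-zeroʳ a)
coeffs-map-* a (b ∷ q) zero    = refl
coeffs-map-* a (b ∷ q) (suc m) = coeffs-map-* a q m

coeffs-0∷ : ∀ p → coeffs (+ 0 ∷ p) ≗ shift 1 (coeffs p)
coeffs-0∷ p zero    = refl
coeffs-0∷ p (suc m) = refl

coeffs-⊗ : ∀ p q → coeffs (p ⊗ q) ≗ mulPoly p (coeffs q)
coeffs-⊗ []      q m = refl
coeffs-⊗ (a ∷ p) q m =
  trans (coeffs-⊕ (map (a *_) q) (+ 0 ∷ (p ⊗ q)) m)
        (cong₂ _+_ (coeffs-map-* a q m) (trans (coeffs-0∷ (p ⊗ q) m) (shift-cong 1 (coeffs-⊗ p q) m)))

mulPoly-cong : ∀ p {F G} → F ≗ G → mulPoly p F ≗ mulPoly p G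
mulPoly-cong []      F≗G m = refl
mulPoly-cong (a ∷ p) F≗G m = cong₂ _+_ (cong (a *_) (F≗G m)) (shift-cong 1 (mulPoly-cong p F≗G) m)

mulPoly-⊕ : ∀ p q F → mulPoly (p ⊕ q) F ≗ mulPoly p F ⊞ mulPoly q F
mulPoly-⊕ []      q       F m = sym (ℤP.+-identityˡ _)
mulPoly-⊕ (a ∷ p) []      F m = sym (ℤP.+-identityʳ _)
mulPoly-⊕ (a ∷ p) (b ∷ q) F m =
  trans (cong (λ x → (a + b) * F m + x) (trans (shift-cong 1 (mulPoly-⊕ p q F) m) (shift-⊞ 1 _ _ m)))
        (distribute a b (F m) _ _)
  where
  distribute : ∀ a b f x y → (a + b) * f + (x + y) ≡ (a * f + x) + (b * f + y)
  distribute = solve-∀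

shift1-𝟘 : shift 1 𝟘 ≗ 𝟘
shift1-𝟘 zero    = refl
shift1-𝟘 (suc m) = refl

mulPoly-mono : ∀ c k F → mulPoly (mono c k) F ≗ c ·ˢ shift k F
mulPoly-mono c zero    F m = trans (cong (λ x → c * F m + x) (shift1-𝟘 m)) (ℤP.+-identityʳ _)
mulPoly-mono c (suc k) F m = begin
  + 0 * F m + shift 1 (mulPoly (mono c k) F) m   ≡⟨ ℤP.+-identityˡ _ ⟩
  shift 1 (mulPoly (mono c k) F) m               ≡⟨ shift-cong 1 (mulPoly-mono c k F) m ⟩
  shift 1 (c ·ˢ shift k F) m                     ≡⟨ shift-·ˢ 1 c (shift k F) m ⟩
  c * shift 1 (shift k F) m                      ≡⟨ cong (c *_) (shift-shift 1 k F m) ⟩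
  c * shift (suc k) F m                          ∎
  where open ≡-Reasoning

mulPoly-1 : ∀ F → mulPoly (+ 1 ∷ []) F ≗ F
mulPoly-1 F m = trans (cong (λ x → + 1 * F m + x) (shift1-𝟘 m)) (trans (ℤP.+-identityʳ _) (ℤP.*-identityˡ _))

qFactor : ℕ → Poly
qFactor j = (+ 1 ∷ []) ⊕ mono (- + 1) (suc (2 ℕ.* j))

mulPoly-qFactor : ∀ j F → mulPoly (qFactor j) F ≗ 1-q^ (odd j) F
mulPoly-qFactor j F m = begin
  mulPoly (qFactor j) F m
    ≡⟨ mulPoly-⊕ (+ 1 ∷ []) (mono (- + 1) e) F m ⟩
  mulPoly (+ 1 ∷ []) F m + mulPoly (mono (- + 1) e) F m
    ≡⟨ cong₂ _+_ (mulPoly-1 F m) (mulPoly-mono (- + 1) e F m) ⟩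
  F m + - + 1 * shift e F m
    ≡⟨ ⊟≗⊞-1·ˢ F (shift e F) m ⟨
  F m - shift e F m
    ≡⟨ cong (λ k → F m - shift (suc (j ℕ.+ k)) F m) (ℕP.+-identityʳ j) ⟩
  1-q^ (odd j) F m
    ∎
  where
  open ≡-Reasoning
  e : ℕ
  e = suc (2 ℕ.* j)

map-applyUpTo : ∀ {A B : Set} (f : A → B) (g : ℕ → A) n → map f (applyUpTo g n) ≡ applyUpTo (f ∘ g) n
map-applyUpTo f g zero    = refl
map-applyUpTo f g (suc n) = cong (f (g 0) ∷_) (map-applyUpTo f (g ∘ suc) n)

coeffs-prodP : ∀ (g : ℕ → Poly) n → coeffs (prodP (applyUpTo g n)) ≗ prodOp (mulPoly ∘ g) 0 n 𝟙
coeffs-prodP g zero    zero    = refl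
coeffs-prodP g zero    (suc m) = refl
coeffs-prodP g (suc n) m = begin
  coeffs (g 0 ⊗ prodP (applyUpTo (g ∘ suc) n)) m
    ≡⟨ coeffs-⊗ (g 0) _ m ⟩
  mulPoly (g 0) (coeffs (prodP (applyUpTo (g ∘ suc) n))) m
    ≡⟨ mulPoly-cong (g 0) (coeffs-prodP (g ∘ suc) n) m ⟩
  mulPoly (g 0) (prodOp (mulPoly ∘ g ∘ suc) 0 n 𝟙) m
    ≡⟨ cong (λ G → mulPoly (g 0) G m) (prodOp-suc (mulPoly ∘ g) 0 n 𝟙) ⟨
  prodOp (mulPoly ∘ g) 0 (suc n) 𝟙 m
    ∎
  where open ≡-Reasoning

coeffs-sumP : ∀ (h : ℕ → Poly) n → coeffs (sumP (applyUpTo h n)) ≗ sumFrom (coeffs ∘ h) 0 n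
coeffs-sumP h zero    m = refl
coeffs-sumP h (suc n) m =
  trans (coeffs-⊕ (h 0) (sumP (applyUpTo (h ∘ suc) n)) m)
        (cong (λ x → coeff m (h 0) + x)
              (trans (coeffs-sumP (h ∘ suc) n m) (sym (sumFrom-suc (coeffs ∘ h) 0 n m))))

coeffs-qPoch : ∀ n → coeffs (qPoch n) ≗ prodOp (1-q^ ∘ odd) 0 n 𝟙
coeffs-qPoch n m = begin
  coeff m (prodP (map qFactor (upTo n)))
    ≡⟨ cong (λ ps → coeff m (prodP ps)) (map-applyUpTo qFactor id n) ⟩
  coeff m (prodP (applyUpTo qFactor n))
    ≡⟨ coeffs-prodP qFactor n m ⟩
  prodOp (mulPoly ∘ qFactor) 0 n 𝟙 m
    ≡⟨ prodOp-cong (λ j → linear (1-q^-multiplier (odd j))) mulPoly-qFactor 0 n 𝟙 m ⟩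
  prodOp (1-q^ ∘ odd) 0 n 𝟙 m
    ∎
  where open ≡-Reasoning

sgn-+ : ∀ a b → sgn (a ℕ.+ b) ≡ sgn a * sgn b
sgn-+ zero    b = sym (ℤP.*-identityˡ (sgn b))
sgn-+ (suc a) b = trans (cong -_ (sgn-+ a b)) (ℤP.neg-distribˡ-* (sgn a) (sgn b))

sgn*sgn : ∀ a → sgn a * sgn a ≡ + 1
sgn*sgn zero    = refl
sgn*sgn (suc a) = trans (neg*neg (sgn a)) (sgn*sgn a)
  where
  neg*neg : ∀ s → (- s) * (- s) ≡ s * s
  neg*neg = solve-∀

sgn-odd : ∀ k → sgn (odd k) ≡ - + 1
sgn-odd k = cong -_ (trans (sgn-+ k k) (sgn*sgn k))

negArg-cong : ∀ {F G} → F ≗ G → negArg F ≗ negArg G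
negArg-cong F≗G m = cong (sgn m *_) (F≗G m)

negArg-shift : ∀ e F → negArg (shift e F) ≗ sgn e ·ˢ shift e (negArg F)
negArg-shift zero    F m       = sym (ℤP.*-identityˡ _)
negArg-shift (suc e) F zero    = sym (ℤP.*-zeroʳ (- sgn e))
negArg-shift (suc e) F (suc m) =
  trans (sym (ℤP.neg-distribˡ-* (sgn m) _)) (trans (cong -_ (negArg-shift e F m)) (ℤP.neg-distribˡ-* (sgn e) _))

negArg-1-q^odd : ∀ k F → negArg (1-q^ (odd k) F) ≗ 1+q^ (odd k) (negArg F)
negArg-1-q^odd k F m = begin
  sgn m * (F m - shift (odd k) F m)
    ≡⟨ *-distribˡ-minus (sgn m) (F m) _ ⟩
  sgn m * F m - negArg (shift (odd k) F) m
    ≡⟨ cong (λ x → sgn m * F m - x) (negArg-shift (odd k) F m) ⟩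
  sgn m * F m - sgn (odd k) * shift (odd k) (negArg F) m
    ≡⟨ cong (λ s → sgn m * F m - s * shift (odd k) (negArg F) m) (sgn-odd k) ⟩
  sgn m * F m - - + 1 * shift (odd k) (negArg F) m
    ≡⟨ minus-minus (sgn m * F m) _ ⟩
  sgn m * F m + shift (odd k) (negArg F) m
    ∎
  where
  open ≡-Reasoning
  *-distribˡ-minus : ∀ s a b → s * (a - b) ≡ s * a - s * b
  *-distribˡ-minus = solve-∀
  minus-minus : ∀ a b → a - - + 1 * b ≡ a + b
  minus-minus = solve-∀

negArg-prodOp : ∀ c n F → negArg (prodOp (1-q^ ∘ odd) c n F) ≗ prodOp (1+q^ ∘ odd) c n (negArg F)
negArg-prodOp c zero    F = ≗-refl
negArg-prodOp c (suc n) F =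
  ≗-trans (negArg-1-q^odd c _) (cong-≗ (linear (1+q^-multiplier (odd c))) (negArg-prodOp (suc c) n F))

negArg-𝟙 : negArg 𝟙 ≗ 𝟙
negArg-𝟙 zero    = refl
negArg-𝟙 (suc m) = ℤP.*-zeroʳ (sgn (suc m))

negArg-sumFrom : ∀ X t c → negArg (sumFrom X t c) ≗ sumFrom (negArg ∘ X) t c
negArg-sumFrom X t zero    m = ℤP.*-zeroʳ (sgn m)
negArg-sumFrom X t (suc c) m =
  trans (ℤP.*-distribˡ-+ (sgn m) _ _) (cong (λ x → sgn m * X t m + x) (negArg-sumFrom X (suc t) c m))

sgn·ˢsgn·ˢ : ∀ a F → sgn a ·ˢ sgn a ·ˢ F ≗ F
sgn·ˢsgn·ˢ a F m = trans (sym (ℤP.*-assoc (sgn a) (sgn a) (F m)))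
                         (trans (cong (_* F m) (sgn*sgn a)) (ℤP.*-identityˡ (F m)))

negArg-νterm : ∀ j → negArg (coeffs (νterm j)) ≗ shift j (negQPoch j)
negArg-νterm j = begin
  negArg (coeffs (νterm j))
    ≈⟨ negArg-cong (≗-trans (coeffs-⊗ (mono (sgn j) j) (qPoch j)) (mulPoly-mono (sgn j) j Q)) ⟩
  negArg (sgn j ·ˢ shift j Q)
    ≈⟨ (λ m → *-comm-middle (sgn m) (sgn j) _) ⟩
  sgn j ·ˢ negArg (shift j Q)
    ≈⟨ cong-≗ (·ˢ-linear (sgn j)) (negArg-shift j Q) ⟩
  sgn j ·ˢ sgn j ·ˢ shift j (negArg Q)
    ≈⟨ sgn·ˢsgn·ˢ j (shift j (negArg Q)) ⟩
  shift j (negArg Q)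
    ≈⟨ shift-cong j (negArg-cong (coeffs-qPoch j)) ⟩
  shift j (negArg (prodOp (1-q^ ∘ odd) 0 j 𝟙))
    ≈⟨ shift-cong j (negArg-prodOp 0 j 𝟙) ⟩
  shift j (prodOp (1+q^ ∘ odd) 0 j (negArg 𝟙))
    ≈⟨ shift-cong j (cong-≗ (linear (prodOp-multiplier (1+q^-multiplier ∘ odd) 0 j)) negArg-𝟙) ⟩
  shift j (negQPoch j)
    ∎
  where
  open ≗-Reasoning
  Q : FPS
  Q = coeffs (qPoch j)
  *-comm-middle : ∀ a b c → a * (b * c) ≡ b * (a * c)
  *-comm-middle = solve-∀

negArg-ν : ∀ m → negArg ν m ≡ Families.ρ (suc m) 0 m
negArg-ν m = begin
  sgn m * coeff m (sumP (map νterm (upTo (suc m))))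
    ≡⟨ cong (λ ps → sgn m * coeff m (sumP ps)) (map-applyUpTo νterm id (suc m)) ⟩
  negArg (coeffs (sumP (applyUpTo νterm (suc m)))) m
    ≡⟨ negArg-cong (coeffs-sumP νterm (suc m)) m ⟩
  negArg (sumFrom (coeffs ∘ νterm) 0 (suc m)) m
    ≡⟨ negArg-sumFrom (coeffs ∘ νterm) 0 (suc m) m ⟩
  sumFrom (negArg ∘ coeffs ∘ νterm) 0 (suc m) m
    ≡⟨ sumFrom-cong (λ j → ≗-trans (negArg-νterm j) (ρTerm₀ j)) 0 (suc m) m ⟩
  sumFrom (ρTerm 0) 0 (suc m) m
    ≡⟨ sumFrom-extend (ρTerm 0) 0 (ℕP.≤-trans (ℕP.n≤1+n _) (ℕP.n≤1+n _))
                      (λ n m<n → ≈-trans (≗⇒≈ (≗-sym (ρTerm₀ n))) (shift-≈𝟘 (negQPoch n) m<n))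
                      m ℕP.≤-refl ⟩
  ρ 0 m
    ∎
  where
  open ≡-Reasoning
  open Families (suc m) using (ρTerm; ρ)
  ρTerm₀ : ∀ n → shift n (negQPoch n) ≗ ρTerm 0 n
  ρTerm₀ n k = cong (λ e → shift e (negQPoch n) k) (sym (ℕP.*-identityʳ n))

sumL : List FPS → FPS
sumL = foldr _⊞_ 𝟘

sumL-map-at : ∀ {A : Set} (f : A → FPS) xs r → sumL (map f xs) r ≡ foldr _+_ (+ 0) (map (λ x → f x r) xs)
sumL-map-at f []       r = refl
sumL-map-at f (x ∷ xs) r = cong (λ y → f x r + y) (sumL-map-at f xs r)

sumL-map-cong : ∀ {A : Set} {f g : A → FPS} → (∀ x → f x ≗ g x) →
                ∀ xs → sumL (map f xs) ≗ sumL (map g xs)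
sumL-map-cong f≗g []       = ≗-refl
sumL-map-cong f≗g (x ∷ xs) = ⊞-cong (f≗g x) (sumL-map-cong f≗g xs)

sumL-map-++ : ∀ {A : Set} (f : A → FPS) xs ys → sumL (map f (xs ++ ys)) ≗ sumL (map f xs) ⊞ sumL (map f ys)
sumL-map-++ f []       ys m = sym (ℤP.+-identityˡ _)
sumL-map-++ f (x ∷ xs) ys m = trans (cong (λ y → f x m + y) (sumL-map-++ f xs ys m)) (sym (ℤP.+-assoc (f x m) _ _))

sumL-map-concatMap : ∀ {A B : Set} (f : B → FPS) (g : A → List B) xs →
                     sumL (map f (concatMap g xs)) ≗ sumL (map (λ x → sumL (map f (g x))) xs)
sumL-map-concatMap f g []       = ≗-refl
sumL-map-concatMap f g (x ∷ xs) =
  ≗-trans (sumL-map-++ f (g x) (concatMap g xs)) (⊞-congʳ (sumL (map f (g x))) (sumL-map-concatMap f g xs))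

sumL-hom : ∀ {T} → Linear T → ∀ Fs → T (sumL Fs) ≗ sumL (map T Fs)
sumL-hom LT []       = 𝟘-hom LT
sumL-hom {T} LT (F ∷ Fs) = ≗-trans (⊞-hom LT F (sumL Fs)) (⊞-congʳ (T F) (sumL-hom LT Fs))

sumL-applyUpTo : ∀ X n → sumL (applyUpTo X n) ≗ sumFrom X 0 n
sumL-applyUpTo X zero    = ≗-refl
sumL-applyUpTo X (suc n) = ⊞-congʳ (X 0) (≗-trans (sumL-applyUpTo (X ∘ suc) n) (≗-sym (sumFrom-suc X 0 n)))

sumL-range : ∀ X b → sumL (map X (range b)) ≗ sumFrom X 0 (suc b)
sumL-range X b m = trans (cong (λ Fs → sumL Fs m) (map-applyUpTo X id (suc b))) (sumL-applyUpTo X (suc b) m)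

sumL-multLists : ∀ (W : List (ℕ × ℕ) → FPS) l b →
                 sumL (map W (multLists (suc l) b))
                 ≗ sumFrom (λ x → sumFrom (λ y → sumL (map (W ∘ ((x , y) ∷_)) (multLists l b))) 0 (suc b)) 0 (suc b)
sumL-multLists W l b = begin
  sumL (map W (concatMap row (range b)))                    ≈⟨ sumL-map-concatMap W row (range b) ⟩
  sumL (map (λ x → sumL (map W (row x))) (range b))         ≈⟨ sumL-map-cong row-sum (range b) ⟩
  sumL (map (λ x → sumFrom (cell x) 0 (suc b)) (range b))   ≈⟨ sumL-range (λ x → sumFrom (cell x) 0 (suc b)) b ⟩
  sumFrom (λ x → sumFrom (cell x) 0 (suc b)) 0 (suc b)      ∎
  where
  open ≗-Reasoning
  row : ℕ → List (List (ℕ × ℕ))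
  row x = concatMap (λ y → map ((x , y) ∷_) (multLists l b)) (range b)
  cell : ℕ → ℕ → FPS
  cell x y = sumL (map (W ∘ ((x , y) ∷_)) (multLists l b))
  row-sum : ∀ x → sumL (map W (row x)) ≗ sumFrom (cell x) 0 (suc b)
  row-sum x = begin
    sumL (map W (row x))   ≈⟨ sumL-map-concatMap W (λ y → map ((x , y) ∷_) (multLists l b)) (range b) ⟩
    sumL (map (λ y → sumL (map W (map ((x , y) ∷_) (multLists l b)))) (range b))
      ≈⟨ sumL-map-cong (λ y m → cong (λ Fs → sumL Fs m) (sym (map-∘ (multLists l b)))) (range b) ⟩
    sumL (map (cell x) (range b))                                     ≈⟨ sumL-range (cell x) b ⟩
    sumFrom (cell x) 0 (suc b)                                        ∎

sumFrom-vanishing : ∀ X t c → (∀ n → X n ≗ 𝟘) → sumFrom X t c ≗ 𝟘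
sumFrom-vanishing X t zero    X≗0 = ≗-refl
sumFrom-vanishing X t (suc c) X≗0 m = cong₂ _+_ (X≗0 t m) (sumFrom-vanishing X (suc t) c X≗0 m)

sumFrom-head : ∀ X c → (∀ n → X (suc n) ≗ 𝟘) → sumFrom X 0 (suc c) ≗ X 0
sumFrom-head X c tail≗0 m =
  trans (cong (λ x → X 0 m + x) (trans (sumFrom-suc X 0 c m) (sumFrom-vanishing (X ∘ suc) 0 c tail≗0 m)))
        (ℤP.+-identityʳ (X 0 m))

sumFrom-head₂ : ∀ X c → (∀ n → X (suc (suc n)) ≗ 𝟘) → sumFrom X 0 (suc (suc c)) ≗ X 0 ⊞ X 1
sumFrom-head₂ X c tail≗0 = ⊞-congʳ (X 0) (≗-trans (sumFrom-suc X 0 (suc c)) (sumFrom-head (X ∘ suc) c tail≗0))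

sumFrom-geom : ∀ e b F → sumFrom (λ x → shift (e ℕ.* x) F) 0 (suc b) ≗ geom e b F
sumFrom-geom e zero    F m = trans (ℤP.+-identityʳ _) (cong (λ x → shift x F m) (ℕP.*-zeroʳ e))
sumFrom-geom e (suc b) F = ⊞-cong (λ m → cong (λ x → shift x F m) (ℕP.*-zeroʳ e)) (begin
  sumFrom (λ x → shift (e ℕ.* x) F) 1 (suc b)
    ≈⟨ sumFrom-suc (λ x → shift (e ℕ.* x) F) 0 (suc b) ⟩
  sumFrom (λ x → shift (e ℕ.* suc x) F) 0 (suc b)
    ≈⟨ sumFrom-cong (λ x → ≗-sym (shift-shift-* e x F)) 0 (suc b) ⟩
  sumFrom (λ x → shift e (shift (e ℕ.* x) F)) 0 (suc b)
    ≈⟨ sumFrom-hom (shift-linear e) _ 0 (suc b) ⟨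
  shift e (sumFrom (λ x → shift (e ℕ.* x) F) 0 (suc b))
    ≈⟨ shift-cong e (sumFrom-geom e b F) ⟩
  shift e (geom e b F)
    ∎)
  where open ≗-Reasoning

sumL-map-leading : ∀ {A : Set} (c e : Bool) (f h : A → FPS) {H} xs → sumL (map h xs) ≗ H →
                   sumL (map (λ x → if c then f x else if e then 𝟘 else h x) xs)
                   ≗ (if c then sumL (map f xs) else if e then 𝟘 else H)
sumL-map-leading true  e     f h xs _   = ≗-refl
sumL-map-leading false true  f h xs _   = sumL-vanishing xs
  where
  sumL-vanishing : ∀ xs → sumL (map (λ _ → 𝟘) xs) ≗ 𝟘
  sumL-vanishing []       = ≗-refl
  sumL-vanishing (x ∷ xs) r = trans (ℤP.+-identityˡ _) (sumL-vanishing xs r)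
sumL-map-leading false false f h xs h≗H = h≗H

allowedAt : ℕ → ℕ → ℕ → Bool
allowedAt k b g = if isEven k then (b ℕ.≤ᵇ 1) ∧ (g ℕ.≤ᵇ 1) else (g ℕ.≡ᵇ 0)

blueEvenAt : ℕ → ℕ → ℕ
blueEvenAt k b = if isEven k then b else 0

when : Bool → ℤ → ℤ
when c v = if c then v else + 0

-- Indexed by the parity of the part size, so that proofs can case on it.
partWeight : Bool → ℕ → ℕ → ℤ
partWeight true  b g = when ((b ℕ.≤ᵇ 1) ∧ (g ℕ.≤ᵇ 1)) (sgn b)
partWeight false b g = when (g ℕ.≡ᵇ 0) (+ 1)

partWeight-spec : ∀ k b g → when (allowedAt k b g) (sgn (blueEvenAt k b)) ≡ partWeight (isEven k) b g
partWeight-spec k b g = spec (isEven k)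
  where
  spec : ∀ e → when (if e then (b ℕ.≤ᵇ 1) ∧ (g ℕ.≤ᵇ 1) else (g ℕ.≡ᵇ 0)) (sgn (if e then b else 0))
                ≡ partWeight e b g
  spec true  = refl
  spec false = refl

partFactor : ℕ → ℕ → ℕ → Op
partFactor k b g F = partWeight (isEven k) b g ·ˢ shift (k ℕ.* (b ℕ.+ g)) F

allowedSeries : ℕ → List (ℕ × ℕ) → FPS
allowedSeries k []             = 𝟙
allowedSeries k ((b , g) ∷ ms) = partFactor k b g (allowedSeries (suc k) ms)

smallestOddSeries : ℕ → List (ℕ × ℕ) → FPS
smallestOddSeries k []             = 𝟘
smallestOddSeries k ((b , g) ∷ ms) =
  if b ℕ.+ g ℕ.≡ᵇ 0 then smallestOddSeries (suc k) ms
  else if isEven k then 𝟘 else allowedSeries k ((b , g) ∷ ms)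

partFactor-linear : ∀ k b g → Linear (partFactor k b g)
partFactor-linear k b g = ∘-linear (·ˢ-linear (partWeight (isEven k) b g)) (shift-linear (k ℕ.* (b ℕ.+ g)))

when-∧-sgn : ∀ C a A u v → when (C ∧ (a ∧ A)) (sgn (u ℕ.+ v)) ≡ when a (sgn u) * when (C ∧ A) (sgn v)
when-∧-sgn C false A u v = cong (λ c → when c _) (∧-zeroʳ C)
when-∧-sgn C true  A u v with C ∧ A
... | true  = sgn-+ u v
... | false = sym (ℤP.*-zeroʳ (sgn u))

when-size : ∀ a s r B v → when ((a ℕ.+ s ℕ.≡ᵇ r) ∧ B) v ≡ shift a (λ r′ → when ((s ℕ.≡ᵇ r′) ∧ B) v) r
when-size zero    s r       B v = refl
when-size (suc a) s zero    B v = refl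
when-size (suc a) s (suc r) B v = when-size a s r B v

allowedSeries-coeff : ∀ k ms r →
  when ((sizeFrom k ms ℕ.≡ᵇ r) ∧ allowed k ms) (sgn (blueEven k ms)) ≡ allowedSeries k ms r
allowedSeries-coeff k []             zero    = refl
allowedSeries-coeff k []             (suc r) = refl
allowedSeries-coeff k ((b , g) ∷ ms) r = begin
  when ((e ℕ.+ s ℕ.≡ᵇ r) ∧ (allowedAt k b g ∧ A)) (sgn (blueEvenAt k b ℕ.+ v))
    ≡⟨ when-∧-sgn (e ℕ.+ s ℕ.≡ᵇ r) (allowedAt k b g) A (blueEvenAt k b) v ⟩
  when (allowedAt k b g) (sgn (blueEvenAt k b)) * when ((e ℕ.+ s ℕ.≡ᵇ r) ∧ A) (sgn v)
    ≡⟨ cong₂ _*_ (partWeight-spec k b g) (when-size e s r A (sgn v)) ⟩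
  w * shift e (λ r′ → when ((s ℕ.≡ᵇ r′) ∧ A) (sgn v)) r
    ≡⟨ cong (w *_) (shift-cong e (allowedSeries-coeff (suc k) ms) r) ⟩
  w * shift e (allowedSeries (suc k) ms) r
    ∎
  where
  open ≡-Reasoning
  e s v : ℕ
  e = k ℕ.* (b ℕ.+ g)
  s = sizeFrom (suc k) ms
  v = blueEven (suc k) ms
  A : Bool
  A = allowed (suc k) ms
  w : ℤ
  w = partWeight (isEven k) b g

when-∧-not : ∀ C A e v X r → when (C ∧ A) v ≡ X r → when (C ∧ (A ∧ not e)) v ≡ (if e then 𝟘 else X) r
when-∧-not C A true  v X r _ =
  trans (cong (λ c → when (C ∧ c) v) (∧-zeroʳ A)) (cong (λ c → when c v) (∧-zeroʳ C))
when-∧-not C A false v X r h = trans (cong (λ c → when (C ∧ c) v) (∧-identityʳ A)) h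

leading-part : ∀ k ms r → when ((sizeFrom k ms ℕ.≡ᵇ r) ∧ allowed k ms ∧ not (isEven k)) (sgn (blueEven k ms))
                          ≡ (if isEven k then 𝟘 else allowedSeries k ms) r
leading-part k ms r = when-∧-not (sizeFrom k ms ℕ.≡ᵇ r) (allowed k ms) (isEven k) (sgn (blueEven k ms))
                                 (allowedSeries k ms) r (allowedSeries-coeff k ms r)

smallestOddSeries-coeff : ∀ k ms r →
  when ((sizeFrom k ms ℕ.≡ᵇ r) ∧ allowed k ms ∧ smallestOdd k ms) (sgn (blueEven k ms)) ≡ smallestOddSeries k ms r
smallestOddSeries-coeff k [] r = cong (λ c → when c (+ 1)) (∧-zeroʳ (0 ℕ.≡ᵇ r))
smallestOddSeries-coeff k ((zero , zero) ∷ ms) r rewrite ℕP.*-zeroʳ k with isEven k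
... | true  = smallestOddSeries-coeff (suc k) ms r
... | false = smallestOddSeries-coeff (suc k) ms r
smallestOddSeries-coeff k ms@((suc _ , _) ∷ _) r = leading-part k ms r
smallestOddSeries-coeff k ms@((zero , suc _) ∷ _) r = leading-part k ms r

module Enumeration (m : ℕ) where

  lists : ℕ → List (List (ℕ × ℕ))
  lists l = multLists l (suc m)

  allowedSum : ℕ → ℕ → FPS
  allowedSum k l = sumL (map (allowedSeries k) (lists l))

  smallestOddSum : ℕ → ℕ → FPS
  smallestOddSum k l = sumL (map (smallestOddSeries k) (lists l))

  Σ² : (ℕ → ℕ → FPS) → FPS
  Σ² f = sumFrom (λ b → sumFrom (f b) 0 (suc (suc m))) 0 (suc (suc m))

  Σ²-cong : ∀ {f g} → (∀ b c → f b c ≗ g b c) → Σ² f ≗ Σ² g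
  Σ²-cong f≗g = sumFrom-cong (λ b → sumFrom-cong (f≗g b) 0 (suc (suc m))) 0 (suc (suc m))

  -- The contribution of the parts of size k: one green and one signed blue part at most,
  -- (1 + q^k)(1 - q^k), for even k; blue parts of multiplicity at most m + 1 for odd k.
  parityFactor : Bool → ℕ → Op
  parityFactor true  k = 1-q^ (k ℕ.+ k)
  parityFactor false k = geom k (suc m)

  factor : ℕ → Op
  factor k = parityFactor (isEven k) k

  factor-multiplier : ∀ k → Multiplier (factor k)
  factor-multiplier k = parity (isEven k)
    where
    parity : ∀ e → Multiplier (parityFactor e k)
    parity true  = 1-q^-multiplier (k ℕ.+ k)
    parity false = geom-multiplier k (suc m)

  partFactors-sum : ∀ k F → Σ² (λ b g → partFactor k b g F) ≗ factor k F
  partFactors-sum k F = parity (isEven k)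
    where
    open ≗-Reasoning
    term : Bool → ℕ → ℕ → FPS
    term e b g = partWeight e b g ·ˢ shift (k ℕ.* (b ℕ.+ g)) F
    cancel : ∀ a b c → (+ 1 * a + + 1 * b) + (- + 1 * b + - + 1 * c) ≡ a - c
    cancel = solve-∀
    k*2 : k ℕ.* 2 ≡ k ℕ.+ k
    k*2 = trans (ℕP.*-comm k 2) (cong (k ℕ.+_) (ℕP.+-identityʳ k))
    parity : ∀ e → Σ² (term e) ≗ parityFactor e k F
    parity false = begin
      Σ² (term false)
        ≈⟨ sumFrom-cong (λ b → sumFrom-head (term false b) (suc m) (λ _ _ → refl)) 0 (suc (suc m)) ⟩
      sumFrom (λ b → + 1 ·ˢ shift (k ℕ.* (b ℕ.+ 0)) F) 0 (suc (suc m))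
        ≈⟨ sumFrom-cong (λ b r → trans (ℤP.*-identityˡ _) (cong (λ e → shift (k ℕ.* e) F r) (ℕP.+-identityʳ b)))
                        0 (suc (suc m)) ⟩
      sumFrom (λ b → shift (k ℕ.* b) F) 0 (suc (suc m))
        ≈⟨ sumFrom-geom k (suc m) F ⟩
      geom k (suc m) F
        ∎
    parity true = begin
      Σ² (term true)
        ≈⟨ sumFrom-head₂ (λ b → sumFrom (term true b) 0 (suc (suc m))) m
                         (λ b → sumFrom-vanishing (term true (suc (suc b))) 0 (suc (suc m)) (λ _ _ → refl)) ⟩
      sumFrom (term true 0) 0 (suc (suc m)) ⊞ sumFrom (term true 1) 0 (suc (suc m))
        ≈⟨ ⊞-cong (sumFrom-head₂ (term true 0) m (λ _ _ → refl))
                  (sumFrom-head₂ (term true 1) m (λ _ _ → refl)) ⟩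
      (term true 0 0 ⊞ term true 0 1) ⊞ (term true 1 0 ⊞ term true 1 1)
        ≈⟨ (λ r → cancel (shift (k ℕ.* 0) F r) (shift (k ℕ.* 1) F r) (shift (k ℕ.* 2) F r)) ⟩
      shift (k ℕ.* 0) F ⊟ shift (k ℕ.* 2) F
        ≈⟨ ⊟-cong (λ r → cong (λ e → shift e F r) (ℕP.*-zeroʳ k)) (λ r → cong (λ e → shift e F r) k*2) ⟩
      1-q^ (k ℕ.+ k) F
        ∎

  allowedSum-suc : ∀ k l → allowedSum k (suc l) ≗ factor k (allowedSum (suc k) l)
  allowedSum-suc k l = begin
    allowedSum k (suc l)
      ≈⟨ sumL-multLists (allowedSeries k) l (suc m) ⟩
    Σ² (λ b g → sumL (map (partFactor k b g ∘ allowedSeries (suc k)) (lists l)))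
      ≈⟨ Σ²-cong (λ b g → ≗-sym (pushFactor b g)) ⟩
    Σ² (λ b g → partFactor k b g (allowedSum (suc k) l))
      ≈⟨ partFactors-sum k (allowedSum (suc k) l) ⟩
    factor k (allowedSum (suc k) l)
      ∎
    where
    open ≗-Reasoning
    pushFactor : ∀ b g → partFactor k b g (allowedSum (suc k) l)
                        ≗ sumL (map (partFactor k b g ∘ allowedSeries (suc k)) (lists l))
    pushFactor b g r = trans (sumL-hom (partFactor-linear k b g) (map (allowedSeries (suc k)) (lists l)) r)
                            (cong (λ Fs → sumL Fs r) (sym (map-∘ (lists l))))

  allowedSum≗prodOp : ∀ k l → allowedSum k l ≗ prodOp factor k l 𝟙
  allowedSum≗prodOp k zero    r = ℤP.+-identityʳ (𝟙 r)
  allowedSum≗prodOp k (suc l) =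
    ≗-trans (allowedSum-suc k l) (cong-≗ (linear (factor-multiplier k)) (allowedSum≗prodOp (suc k) l))

  leadingTerm : Bool → ℕ → FPS → FPS → ℕ → ℕ → FPS
  leadingTerm e k G F b g =
    if b ℕ.+ g ℕ.≡ᵇ 0 then G else if e then 𝟘 else partWeight e b g ·ˢ shift (k ℕ.* (b ℕ.+ g)) F

  leadingTerms-sum : ∀ e k G F → Σ² (leadingTerm e k G F) ≗ (if e then G else G ⊞ shift k (geom k m F))
  leadingTerms-sum e k G F = parity e
    where
    open ≗-Reasoning
    row : Bool → ℕ → FPS
    row e b = sumFrom (leadingTerm e k G F b) 0 (suc (suc m))
    first-row : ∀ e → row e 0 ≗ G
    first-row true  = sumFrom-head (leadingTerm true k G F 0) (suc m) (λ _ _ → refl)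
    first-row false = sumFrom-head (leadingTerm false k G F 0) (suc m) (λ _ _ → refl)
    odd-row : ∀ b → row false (suc b) ≗ shift k (shift (k ℕ.* b) F)
    odd-row b r = trans (sumFrom-head (leadingTerm false k G F (suc b)) (suc m) (λ _ _ → refl) r)
                 (trans (ℤP.*-identityˡ _)
                 (trans (cong (λ e → shift (k ℕ.* e) F r) (ℕP.+-identityʳ (suc b))) (sym (shift-shift-* k b F r))))
    parity : ∀ e → sumFrom (row e) 0 (suc (suc m)) ≗ (if e then G else G ⊞ shift k (geom k m F))
    parity true = begin
      row true 0 ⊞ sumFrom (row true) 1 (suc m)
        ≈⟨ ⊞-congʳ (row true 0) (sumFrom-suc (row true) 0 (suc m)) ⟩
      row true 0 ⊞ sumFrom (row true ∘ suc) 0 (suc m)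
        ≈⟨ ⊞-congʳ (row true 0) (sumFrom-vanishing (row true ∘ suc) 0 (suc m)
             (λ b → sumFrom-vanishing (leadingTerm true k G F (suc b)) 0 (suc (suc m)) (λ _ _ → refl))) ⟩
      row true 0 ⊞ 𝟘
        ≈⟨ (λ r → ℤP.+-identityʳ _) ⟩
      row true 0
        ≈⟨ first-row true ⟩
      G
        ∎
    parity false = ⊞-cong (first-row false) (begin
      sumFrom (row false) 1 (suc m)
        ≈⟨ sumFrom-suc (row false) 0 (suc m) ⟩
      sumFrom (row false ∘ suc) 0 (suc m)
        ≈⟨ sumFrom-cong odd-row 0 (suc m) ⟩
      sumFrom (λ b → shift k (shift (k ℕ.* b) F)) 0 (suc m)
        ≈⟨ sumFrom-hom (shift-linear k) (λ b → shift (k ℕ.* b) F) 0 (suc m) ⟨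
      shift k (sumFrom (λ b → shift (k ℕ.* b) F) 0 (suc m))
        ≈⟨ shift-cong k (sumFrom-geom k m F) ⟩
      shift k (geom k m F)
        ∎)

  withSmallest : ℕ → ℕ → FPS
  withSmallest k l = shift k (geom k m (allowedSum (suc k) l))

  smallestOddStep : ℕ → ℕ → FPS
  smallestOddStep k l = if isEven k then smallestOddSum (suc k) l else smallestOddSum (suc k) l ⊞ withSmallest k l

  smallestOddStep-odd : ∀ k l → isEven k ≡ false → smallestOddStep k l ≗ smallestOddSum (suc k) l ⊞ withSmallest k l
  smallestOddStep-odd k l k-odd r =
    cong (λ e → (if e then smallestOddSum (suc k) l else smallestOddSum (suc k) l ⊞ withSmallest k l) r) k-odd

  smallestOddStep-even : ∀ k l → isEven k ≡ true → smallestOddStep k l ≗ smallestOddSum (suc k) l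
  smallestOddStep-even k l k-even r =
    cong (λ e → (if e then smallestOddSum (suc k) l else smallestOddSum (suc k) l ⊞ withSmallest k l) r) k-even

  smallestOddSum-suc : ∀ k l → smallestOddSum k (suc l) ≗ smallestOddStep k l
  smallestOddSum-suc k l = begin
    smallestOddSum k (suc l)
      ≈⟨ sumL-multLists (smallestOddSeries k) l (suc m) ⟩
    Σ² (λ b g → sumL (map (smallestOddSeries k ∘ ((b , g) ∷_)) (lists l)))
      ≈⟨ Σ²-cong leading ⟩
    Σ² (leadingTerm (isEven k) k (smallestOddSum (suc k) l) (allowedSum (suc k) l))
      ≈⟨ leadingTerms-sum (isEven k) k (smallestOddSum (suc k) l) (allowedSum (suc k) l) ⟩
    smallestOddStep k l
      ∎
    where
    open ≗-Reasoning
    leading : ∀ b g → sumL (map (smallestOddSeries k ∘ ((b , g) ∷_)) (lists l))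
                      ≗ leadingTerm (isEven k) k (smallestOddSum (suc k) l) (allowedSum (suc k) l) b g
    leading b g = sumL-map-leading (b ℕ.+ g ℕ.≡ᵇ 0) (isEven k) (smallestOddSeries (suc k))
                    (partFactor k b g ∘ allowedSeries (suc k)) (lists l)
                    (λ r → trans (cong (λ Fs → sumL Fs r) (map-∘ (lists l)))
                                 (sym (sumL-hom (partFactor-linear k b g) (map (allowedSeries (suc k)) (lists l)) r)))

isEven-double : ∀ t → isEven (t ℕ.+ t) ≡ true
isEven-double zero    = refl
isEven-double (suc t) = trans (cong (not ∘ isEven) (ℕP.+-suc t t)) (cong (not ∘ not) (isEven-double t))

isEven-odd : ∀ t → isEven (odd t) ≡ false
isEven-odd t = cong not (isEven-double t)

isEven-suc-odd : ∀ t → isEven (suc (odd t)) ≡ true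
isEven-suc-odd t = cong not (isEven-odd t)

suc-odd-suc : ∀ t → suc (suc (odd t)) ≡ odd (suc t)
suc-odd-suc t = cong (suc ∘ suc) (sym (ℕP.+-suc t t))

suc+suc : ∀ c → suc c ℕ.+ suc c ≡ suc (suc (c ℕ.+ c))
suc+suc c = cong suc (ℕP.+-suc c c)

module LeftSide (m : ℕ) where

  P : ℕ
  P = suc m

  open Enumeration m
  open Families P

  factor-idUpTo : ∀ j → P < j → IsIdUpTo P (factor j)
  factor-idUpTo j P<j = parity (isEven j)
    where
    parity : ∀ e → IsIdUpTo P (parityFactor e j)
    parity true  = 1-q^-idUpTo (ℕP.≤-trans P<j (ℕP.m≤m+n j j))
    parity false = geom-idUpTo (suc m) P<j

  allowedSum-extend : ∀ k l → P < k ℕ.+ l → allowedSum k l ≈[ P ] allowedSum k (suc l)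
  allowedSum-extend k l P<k+l = begin
    allowedSum k l              ≈⟨ ≗⇒≈ (allowedSum≗prodOp k l) ⟩
    prodOp factor k l 𝟙         ≈⟨ prodOp-extend factor-multiplier k (ℕP.n≤1+n l) factor≈id 𝟙 ⟩
    prodOp factor k (suc l) 𝟙   ≈⟨ ≗⇒≈ (allowedSum≗prodOp k (suc l)) ⟨
    allowedSum k (suc l)        ∎
    where
    open ≈-Reasoning P
    factor≈id : IdUpToFrom P factor (k ℕ.+ l)
    factor≈id j k+l≤j = factor-idUpTo j (ℕP.<-≤-trans P<k+l k+l≤j)

  if-cong-≈ : ∀ e {X X′ Y Y′} → X ≈[ P ] X′ → Y ≈[ P ] Y′ →
              (if e then X else Y) ≈[ P ] (if e then X′ else Y′)
  if-cong-≈ true  X≈X′ _    = X≈X′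
  if-cong-≈ false _    Y≈Y′ = Y≈Y′

  smallestOddSum-extend : ∀ k l → P < k ℕ.+ l → smallestOddSum k l ≈[ P ] smallestOddSum k (suc l)
  smallestOddSum-extend k zero P<k = ≈-sym (≈-trans (≗⇒≈ (smallestOddSum-suc k 0)) (vanish (isEven k)))
    where
    vanish : ∀ e → (if e then 𝟘 else 𝟘 ⊞ withSmallest k 0) ≈[ P ] 𝟘
    vanish true  = ≈-refl
    vanish false r r≤P = trans (ℤP.+-identityˡ _) (shift-≈𝟘 _ (subst (P <_) (ℕP.+-identityʳ k) P<k) r r≤P)
  smallestOddSum-extend k (suc l) P<k+l = begin
    smallestOddSum k (suc l)
      ≈⟨ ≗⇒≈ (smallestOddSum-suc k l) ⟩
    smallestOddStep k l
      ≈⟨ if-cong-≈ (isEven k) IH (⊞-cong-≈ IH (cong-≈ shift∘geom (allowedSum-extend (suc k) l P<k+1+l))) ⟩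
    smallestOddStep k (suc l)
      ≈⟨ ≗⇒≈ (smallestOddSum-suc k (suc l)) ⟨
    smallestOddSum k (suc (suc l))
      ∎
    where
    open ≈-Reasoning P
    P<k+1+l : P < suc k ℕ.+ l
    P<k+1+l = subst (P <_) (ℕP.+-suc k l) P<k+l
    IH : smallestOddSum (suc k) l ≈[ P ] smallestOddSum (suc k) (suc l)
    IH = smallestOddSum-extend (suc k) l P<k+1+l
    shift∘geom : Linear (shift k ∘ geom k m)
    shift∘geom = ∘-linear (shift-linear k) (linear (geom-multiplier k m))

  smallestOddSum-pad : ∀ d k l → P < k ℕ.+ l → smallestOddSum k l ≈[ P ] smallestOddSum k (d ℕ.+ l)
  smallestOddSum-pad zero    k l P<k+l = ≈-refl
  smallestOddSum-pad (suc d) k l P<k+l =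
    ≈-trans (smallestOddSum-pad d k l P<k+l)
            (smallestOddSum-extend k (d ℕ.+ l) (ℕP.<-≤-trans P<k+l (ℕP.+-monoʳ-≤ k (ℕP.m≤n+m l d))))

  pairFactor : ℕ → Op
  pairFactor u = factor (odd u) ∘ factor (suc (odd u))

  pairFactor-multiplier : ∀ u → Multiplier (pairFactor u)
  pairFactor-multiplier u = ∘-multiplier (factor-multiplier (odd u)) (factor-multiplier (suc (odd u)))

  pairFactor-idUpTo : ∀ u → P < odd u → IsIdUpTo P (pairFactor u)
  pairFactor-idUpTo u P<odd-u =
    ∘-idUpTo (linear (factor-multiplier (odd u))) (factor-idUpTo (odd u) P<odd-u)
             (factor-idUpTo (suc (odd u)) (ℕP.m≤n⇒m≤1+n P<odd-u))

  prodOp-pairs : ∀ c t F → prodOp factor (odd t) (c ℕ.+ c) F ≗ prodOp pairFactor t c F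
  prodOp-pairs zero    t F = ≗-refl
  prodOp-pairs (suc c) t F r = begin
    prodOp factor (odd t) (suc c ℕ.+ suc c) F r
      ≡⟨ cong (λ l → prodOp factor (odd t) l F r) (suc+suc c) ⟩
    pairFactor t (prodOp factor (suc (suc (odd t))) (c ℕ.+ c) F) r
      ≡⟨ cong (λ k → pairFactor t (prodOp factor k (c ℕ.+ c) F) r) (suc-odd-suc t) ⟩
    pairFactor t (prodOp factor (odd (suc t)) (c ℕ.+ c) F) r
      ≡⟨ cong-≗ (linear (pairFactor-multiplier t)) (prodOp-pairs c (suc t) F) r ⟩
    prodOp pairFactor t (suc c) F r
      ∎
    where open ≡-Reasoning

  evenMinus∘ratio : ∀ u F → evenMinus u (ratio u F) ≗ pairFactor u F
  evenMinus∘ratio u F r = begin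
    evenMinus u (geom (odd u) P (1+q^ (suc (odd u)) F)) r
      ≡⟨ swap (evenMinus-multiplier u) (geom-multiplier (odd u) P) (1+q^ (suc (odd u)) F) r ⟩
    geom (odd u) P (1-q^ (suc (odd u)) (1+q^ (suc (odd u)) F)) r
      ≡⟨ cong-≗ (linear (geom-multiplier (odd u) P)) (1-q^∘1+q^ (suc (odd u)) F) r ⟩
    geom (odd u) P (1-q^ (suc (odd u) ℕ.+ suc (odd u)) F) r
      ≡⟨ cong₂ (λ e e′ → parityFactor e (odd u) (parityFactor e′ (suc (odd u)) F) r)
               (isEven-odd u) (isEven-suc-odd u) ⟨
    pairFactor u F r
      ∎
    where open ≡-Reasoning

  B∘K≈pairs : ∀ t c → P ≤ (t ℕ.+ t) ℕ.+ (suc c ℕ.+ suc c) →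
              B t (K t 𝟙) ≈[ P ] prodOp pairFactor t (suc c) 𝟙
  B∘K≈pairs t c P≤ = begin
    B t (K t 𝟙)
      ≈⟨ ≗⇒≈ (prodOp-interleave evenMinus-multiplier ratio-multiplier t L 𝟙) ⟩
    prodOp (λ u → evenMinus u ∘ ratio u) t L 𝟙
      ≈⟨ ≗⇒≈ (prodOp-cong (linear ∘ pairFactor-multiplier) evenMinus∘ratio t L 𝟙) ⟩
    prodOp pairFactor t L 𝟙
      ≈⟨ prodOp-stable pairFactor-multiplier t L (suc c) beyond-L beyond-c 𝟙 ⟩
    prodOp pairFactor t (suc c) 𝟙
      ∎
    where
    open ≈-Reasoning P
    double-≤ : ∀ {j} → t ℕ.+ suc c ≤ j → (t ℕ.+ t) ℕ.+ (suc c ℕ.+ suc c) ≤ j ℕ.+ j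
    double-≤ {j} h = ℕP.≤-trans (ℕP.≤-reflexive (regroup t c)) (ℕP.+-mono-≤ h h)
      where
      regroup : ∀ t c → (t ℕ.+ t) ℕ.+ (suc c ℕ.+ suc c) ≡ (t ℕ.+ suc c) ℕ.+ (t ℕ.+ suc c)
      regroup = ℕSolver.solve-∀
    beyond-L : IdUpToFrom P pairFactor (t ℕ.+ L)
    beyond-L j t+L≤j = pairFactor-idUpTo j (P<odd j (P<beyond t j t+L≤j))
    beyond-c : IdUpToFrom P pairFactor (t ℕ.+ suc c)
    beyond-c j t+c<j = pairFactor-idUpTo j (s≤s (ℕP.≤-trans P≤ (double-≤ t+c<j)))

  shift-geom-suc : ∀ e b F → P < e ℕ.* suc (suc b) → shift e (geom e b F) ≈[ P ] shift e (geom e (suc b) F)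
  shift-geom-suc e b F P<e*b r r≤P = sym (begin
    shift e (geom e (suc b) F) r
      ≡⟨ shift-cong e (geom-suc e b F) r ⟩
    shift e (geom e b F ⊞ shift (e ℕ.* suc b) F) r
      ≡⟨ shift-⊞ e _ _ r ⟩
    shift e (geom e b F) r + shift e (shift (e ℕ.* suc b) F) r
      ≡⟨ cong (λ x → shift e (geom e b F) r + x) (trans (shift-shift-* e (suc b) F r) (shift-≈𝟘 F P<e*b r r≤P)) ⟩
    shift e (geom e b F) r + + 0
      ≡⟨ ℤP.+-identityʳ _ ⟩
    shift e (geom e b F) r
      ∎)
    where open ≡-Reasoning

  withSmallest≈σTerm : ∀ t c → P ≤ (t ℕ.+ t) ℕ.+ (suc c ℕ.+ suc c) →
                       withSmallest (odd t) (suc (c ℕ.+ c)) ≈[ P ] shift 1 (σTerm 0 t)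
  withSmallest≈σTerm t c P≤ = begin
    shift (odd t) (geom (odd t) m Z)
      ≈⟨ shift-geom-suc (odd t) m Z (ℕP.m≤n*m (suc (suc m)) (odd t)) ⟩
    shift (odd t) (geom (odd t) (suc m) Z)
      ≈⟨ ≗⇒≈ (shift-cong (odd t) (λ r → cong (λ e → parityFactor e (odd t) Z r) (sym (isEven-odd t)))) ⟩
    shift (odd t) (factor (odd t) Z)
      ≈⟨ ≗⇒≈ (shift-cong (odd t) (cong-≗ (linear (factor-multiplier (odd t))) (allowedSum≗prodOp _ l))) ⟩
    shift (odd t) (prodOp factor (odd t) (suc l) 𝟙)
      ≈⟨ ≗⇒≈ (λ r → cong (λ l → shift (odd t) (prodOp factor (odd t) l 𝟙) r) (sym (suc+suc c))) ⟩
    shift (odd t) (prodOp factor (odd t) (suc c ℕ.+ suc c) 𝟙)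
      ≈⟨ ≗⇒≈ (shift-cong (odd t) (prodOp-pairs (suc c) t 𝟙)) ⟩
    shift (odd t) (prodOp pairFactor t (suc c) 𝟙)
      ≈⟨ shift-cong-≈ (odd t) (B∘K≈pairs t c P≤) ⟨
    shift (odd t) (B t (K t 𝟙))
      ≈⟨ ≗⇒≈ (≗-sym (shift-shift 1 (t ℕ.+ t) (B t (K t 𝟙)))) ⟩
    shift 1 (σTerm 0 t)
      ∎
    where
    open ≈-Reasoning P
    l : ℕ
    l = suc (c ℕ.+ c)
    Z : FPS
    Z = allowedSum (suc (odd t)) l

  smallestOddSum-odd : ∀ t l → smallestOddSum (odd t) (suc l) ≗ smallestOddSum (suc (odd t)) l ⊞ withSmallest (odd t) l
  smallestOddSum-odd t l = ≗-trans (smallestOddSum-suc (odd t) l) (smallestOddStep-odd (odd t) l (isEven-odd t))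

  smallestOddSum-even : ∀ t l → smallestOddSum (suc (odd t)) (suc l) ≗ smallestOddSum (odd (suc t)) l
  smallestOddSum-even t l = ≗-trans (smallestOddSum-suc (suc (odd t)) l)
    (≗-trans (smallestOddStep-even (suc (odd t)) l (isEven-suc-odd t))
             (λ r → cong (λ k → smallestOddSum k l r) (suc-odd-suc t)))

  smallestOddSum≈σTerms : ∀ c t → P ≤ (t ℕ.+ t) ℕ.+ (c ℕ.+ c) →
                          smallestOddSum (odd t) (c ℕ.+ c) ≈[ P ] shift 1 (sumFrom (σTerm 0) t c)
  smallestOddSum≈σTerms zero    t _  r _ = sym (shift1-𝟘 r)
  smallestOddSum≈σTerms (suc c) t P≤ = begin
    smallestOddSum (odd t) (suc c ℕ.+ suc c)
      ≈⟨ ≗⇒≈ (λ r → cong (λ l → smallestOddSum (odd t) l r) (suc+suc c)) ⟩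
    smallestOddSum (odd t) (suc (suc (c ℕ.+ c)))
      ≈⟨ ≗⇒≈ (smallestOddSum-odd t l) ⟩
    smallestOddSum (suc (odd t)) l ⊞ withSmallest (odd t) l
      ≈⟨ ⊞-cong-≈ (≈-trans (≗⇒≈ (smallestOddSum-even t (c ℕ.+ c))) (smallestOddSum≈σTerms c (suc t) P≤′))
                  (withSmallest≈σTerm t c P≤) ⟩
    shift 1 (sumFrom (σTerm 0) (suc t) c) ⊞ shift 1 (σTerm 0 t)
      ≈⟨ ≗⇒≈ (λ r → ℤP.+-comm (shift 1 (sumFrom (σTerm 0) (suc t) c) r) _) ⟩
    shift 1 (σTerm 0 t) ⊞ shift 1 (sumFrom (σTerm 0) (suc t) c)
      ≈⟨ ≗⇒≈ (≗-sym (shift-⊞ 1 (σTerm 0 t) (sumFrom (σTerm 0) (suc t) c))) ⟩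
    shift 1 (sumFrom (σTerm 0) t (suc c))
      ∎
    where
    open ≈-Reasoning P
    l : ℕ
    l = suc (c ℕ.+ c)
    P≤′ : P ≤ (suc t ℕ.+ suc t) ℕ.+ (c ℕ.+ c)
    P≤′ = ℕP.≤-trans P≤ (ℕP.≤-reflexive (regroup t c))
      where
      regroup : ∀ t c → (t ℕ.+ t) ℕ.+ (suc c ℕ.+ suc c) ≡ (suc t ℕ.+ suc t) ℕ.+ (c ℕ.+ c)
      regroup = ℕSolver.solve-∀

  Tν≡σ : Tν P ≡ σ 0 m
  Tν≡σ = begin
    foldr _+_ (+ 0) (map (weight P) (lists P))
      ≡⟨ cong (foldr _+_ (+ 0)) (map-cong (λ ms → smallestOddSeries-coeff 1 ms P) (lists P)) ⟩
    foldr _+_ (+ 0) (map (λ ms → smallestOddSeries 1 ms P) (lists P))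
      ≡⟨ sumL-map-at (smallestOddSeries 1) (lists P) P ⟨
    smallestOddSum 1 P P
      ≡⟨ smallestOddSum-pad P 1 P ℕP.≤-refl P ℕP.≤-refl ⟩
      -- an even number of part sizes, so that they can be grouped into pairs 2t+1, 2t+2
    smallestOddSum 1 (P ℕ.+ P) P
      ≡⟨ smallestOddSum≈σTerms P 0 (ℕP.m≤m+n P P) P ℕP.≤-refl ⟩
    sumFrom (σTerm 0) 0 P m
      ≡⟨ sumFrom-extend (σTerm 0) 0 (ℕP.≤-trans (ℕP.n≤1+n P) (ℕP.n≤1+n L)) σTerm≈𝟘 m (ℕP.n≤1+n m) ⟩
    σ 0 m
      ∎
    where
    open ≡-Reasoning
    σTerm≈𝟘 : ∀ n → P ≤ n → σTerm 0 n ≈[ P ] 𝟘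
    σTerm≈𝟘 n P≤n = shift-≈𝟘 _ (ℕP.≤-trans (s≤s P≤n) (ℕP.+-monoˡ-≤ n (ℕP.≤-trans (s≤s z≤n) P≤n)))

theorem4 : (n : ℕ) → Tseries n ≡ qTimes (negArg ν) n
theorem4 zero    = refl
theorem4 (suc m) = begin
  Tν (suc m)                    ≡⟨ LeftSide.Tν≡σ m ⟩
  Families.σ (suc m) 0 m        ≡⟨ Families.σ≈ρ (suc m) m (ℕP.n≤1+n m) ⟩
  Families.ρ (suc m) 0 m        ≡⟨ negArg-ν m ⟨
  negArg ν m                    ∎
  where open ≡-Reasoning
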